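{- For every $n\ge1$, the statistic $\operatorname{blk}$ on $\operatorname{NDPM}_n$ is equidistributed with the statistic $\operatorname{touch}$ on $\mathbb{D}_n$. In particular, as formal power series, $$\sum_{A\in\operatorname{NDPM}}x^{\operatorname{blk}(A)}t^{w(A)}=\frac{x-2x^2t-x\sqrt{1-4t}}{2-2x+2x^2t}.$$
   Context: For $n\ge1$ let $[n]=\{1,\ldots,n\}$. A partition matrix on $[n]$ is an upper-triangular square matrix whose entries are subsets of $[n]$ (entries below the diagonal are empty) such that: each row and each column contains at least one nonempty entry; the nonempty entries form a set partition of $[n]$; and for all $i,j\in[n]$, if $\operatorname{col}(i)<\operatorname{col}(j)$ then $i<j$, where $\operatorname{col}(k)$ (resp. $\operatorname{row}(k)$) is the column (resp. row) index of the entry containing $k$. Its weight $w$ is $n$. It is nondecreasing if for all $i<j$ in $[n]$, $\operatorname{row}(i)\le\operatorname{row}(j)$ and $\operatorname{col}(i)\le\operatorname{col}(j)$. $\operatorname{NDPM}_n$ is the set of nondecreasing partition matrices on $[n]$ and $\operatorname{NDPM}=\bigcup_{n\ge1}\operatorname{NDPM}_n$. $\operatorname{blk}(A)$ is the number of irreducible diagonal blocks of $A$ (blocks in the finest decomposition of $A$ as a block-diagonal matrix of square diagonal blocks with all entries outside them empty). A Dyck path of semilength $n$ is a lattice path from $(0,0)$ to $(n,n)$ with unit east and north steps that never goes above the diagonal $y=x$ (it may touch it); $\mathbb{D}_n$ is the set of these, and $\operatorname{touch}(\mathcal{D})$ is the number of lattice points of $\mathcal{D}$ on the diagonal other than the starting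 point $(0,0)$. The square root denotes the power series with constant term $1$. -}

module Defs where

open import Data.Nat using (ℕ; zero; suc; _+_; _∸_; _≤_; _<_; _<ᵇ_; _≤ᵇ_)
open import Data.Bool using (Bool; true; false; _∧_; _∨_)
open import Data.Fin as Fin using (Fin; toℕ)
open import Data.Vec using (Vec; lookup; foldr)
open import Data.List as List using (List; []; _∷_; length; filter; map; upTo)
open import Data.List.Relation.Unary.All using (All)
open import Data.Product using (Σ; ∃; _×_; _,_; proj₁; proj₂)
open import Data.Integer as ℤ using (ℤ; +_)
open import Relation.Binary.PropositionalEquality using (_≡_)
import Data.Nat as ℕ
open import Relation.Nullary using (yes; no)

-- A partition matrix of size m × m on [n] is encoded by m together with
-- the row- and column-index of the entry containing each element
-- k ∈ [n] (elements are Fin n, i.e. k ↦ k+1; indices are Fin m).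
-- The matrix is then  entry(r,c) = { k | row k = r , col k = c }, so the
-- nonempty entries automatically form a set partition of [n]; the
-- correspondence matrix ↔ (m , row , col) is bijective.
-- Proof fields are irrelevant, so two NDPMs are equal iff they have the
-- same data (m , row , col), i.e. iff they are the same matrix.

record NDPM (n : ℕ) : Set where
  field
    m   : ℕ
    row : Vec (Fin m) n
    col : Vec (Fin m) n
    .upper      : ∀ (k : Fin n) → lookup row k Fin.≤ lookup col k
    .rowNonempty : ∀ (r : Fin m) → ∃ λ (k : Fin n) → lookup row k ≡ r
    .colNonempty : ∀ (c : Fin m) → ∃ λ (k : Fin n) → lookup col k ≡ c
    .colCond    : ∀ (i j : Fin n) → lookup col i Fin.< lookup col j → i Fin.< j
    .nondecreasing : ∀ (i j : Fin n) → i Fin.< j →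
                     (lookup row i Fin.≤ lookup row j) × (lookup col i Fin.≤ lookup col j)

open NDPM public

-- The matrix splits block-diagonally between index c and c+1 (i.e. after
-- the first c rows/columns, 1 ≤ c ≤ m-1) iff no nonempty entry (r , c')
-- has r < c ≤ c' (0-based: row < c and c ≤ col).
isCut : ∀ {n m} → Vec (Fin m) n → Vec (Fin m) n → ℕ → Bool
isCut {zero}  row col c = true
isCut {suc n} (r Data.Vec.∷ rs) (k Data.Vec.∷ ks) c =
  ((toℕ k <ᵇ c) ∨ (c ≤ᵇ toℕ r)) ∧ isCut rs ks c

-- number of irreducible diagonal blocks = 1 + number of cut positions
blk : ∀ {n} → NDPM n → ℕ
blk A = suc (length (filter (λ c → Data.Bool._≟_ (isCut (row A) (col A) c) true)
                            (map suc (upTo (m A ∸ 1)))))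

data Step : Set where
  E N : Step

pointsFrom : ℕ → ℕ → List Step → List (ℕ × ℕ)
pointsFrom x y []       = []
pointsFrom x y (E ∷ s)  = (suc x , y) ∷ pointsFrom (suc x) y s
pointsFrom x y (N ∷ s)  = (x , suc y) ∷ pointsFrom x (suc y) s

-- all lattice points of the path other than the starting point (0,0)
points : List Step → List (ℕ × ℕ)
points = pointsFrom 0 0

endpoint : List Step → ℕ × ℕ
endpoint []      = (0 , 0)
endpoint (E ∷ s) = (suc (proj₁ (endpoint s)) , proj₂ (endpoint s))
endpoint (N ∷ s) = (proj₁ (endpoint s) , suc (proj₂ (endpoint s)))

record Dyck (n : ℕ) : Set where
  field
    path   : List Step
    .below : All (λ p → proj₂ p ≤ proj₁ p) (points path)
    .ends  : endpoint path ≡ (n , n)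

open Dyck public

touch : ∀ {n} → Dyck n → ℕ
touch D = length (filter (λ p → proj₁ p ℕ.≟ proj₂ p) (points (path D)))

-- Formal power series in x, t over ℤ:  S i j = coefficient of x^i t^j

Series : Set
Series = ℕ → ℕ → ℤ

_≈ₛ_ : Series → Series → Set
f ≈ₛ g = ∀ i j → f i j ≡ g i j

sumTo : ℕ → (ℕ → ℤ) → ℤ
sumTo zero    f = f 0
sumTo (suc i) f = sumTo i f ℤ.+ f (suc i)

_⋆_ : Series → Series → Series
(f ⋆ g) i j = sumTo i λ a → sumTo j λ b → f a b ℤ.* g (i ∸ a) (j ∸ b)

mono : ℤ → ℕ → ℕ → Series
mono c a b i j with i ℕ.≟ a | j ℕ.≟ b
... | yes _ | yes _ = c
... | _ | _ = + 0

_⊕_ : Series → Series → Series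
(f ⊕ g) i j = f i j ℤ.+ g i j

_⊖_ : Series → Series → Series
(f ⊖ g) i j = f i j ℤ.- g i j

oneMinus4t : Series
oneMinus4t = mono (+ 1) 0 0 ⊖ mono (+ 4) 0 1

denom : Series
denom = (mono (+ 2) 0 0 ⊖ mono (+ 2) 1 0) ⊕ mono (+ 2) 2 1

-- numerator x - 2x²t - x·S  where S stands for √(1-4t)
numer : Series → Series
numer S = (mono (+ 1) 1 0 ⊖ mono (+ 2) 2 1) ⊖ (mono (+ 1) 1 0 ⋆ S)

-- Σ_{A ∈ NDPM} x^{blk A} t^{w(A)}, given c n k = #{A ∈ NDPM_n | blk A = k}
-- for n ≥ 1 (NDPM = ⋃_{n≥1} NDPM_n, so the t^0 coefficients vanish)
genSeries : (ℕ → ℕ → ℕ) → Series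
genSeries c k zero    = + 0
genSeries c k (suc n) = + c (suc n) k

-- Both statistics are read off one family of paths: Motzkin paths with two kinds of level step, k counting the
-- level steps of the second kind taken at height 0. Listing the cells of 1, 2, …, n, each cell of a
-- nondecreasing partition matrix is the previous one moved by nothing, one column, one row or one diagonal step,
-- with height = distance from the diagonal, and a new irreducible block begins exactly at a diagonal move made on
-- the diagonal. After its first step a Dyck path splits into pairs of steps (EN, EE, NN, NE) and a final N, with
-- returns to the diagonal in the role of new blocks. These paths are counted by ballot numbers. As √(1 - 4t) is
-- the unique square root with constant term 1, it is 1 - 2 ∑ Cₙ tⁿ⁺¹, and the generating function identity
-- reduces coefficientwise to the recursion of the ballot numbers.
module Submission where

module PowerSeries where

  open import Defs
  open import Data.Nat as ℕ using (ℕ; zero; suc; _∸_; z≤n; s≤s)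
  import Data.Nat.Properties as ℕₚ
  open import Data.Integer using (ℤ; +_; _+_; _*_; _-_)
  import Data.Integer.Properties as ℤₚ
  open import Data.Integer.Tactic.RingSolver using (solve-∀)
  open import Data.Sum using (_⊎_; inj₁; inj₂)
  import Data.Sum as Sum
  open import Function using (_∘_)
  open import Relation.Nullary using (¬_; yes; no; contradiction)
  open import Relation.Binary.PropositionalEquality

  sumTo-cong : ∀ i {f g : ℕ → ℤ} → (∀ a → a ℕ.≤ i → f a ≡ g a) → sumTo i f ≡ sumTo i g
  sumTo-cong zero    f≗g = f≗g 0 z≤n
  sumTo-cong (suc i) f≗g =
    cong₂ _+_ (sumTo-cong i (λ a a≤i → f≗g a (ℕₚ.m≤n⇒m≤1+n a≤i))) (f≗g (suc i) ℕₚ.≤-refl)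

  sumTo-zero : ∀ i {f : ℕ → ℤ} → (∀ a → a ℕ.≤ i → f a ≡ + 0) → sumTo i f ≡ + 0
  sumTo-zero zero    f≗0 = f≗0 0 z≤n
  sumTo-zero (suc i) f≗0 =
    cong₂ _+_ (sumTo-zero i (λ a a≤i → f≗0 a (ℕₚ.m≤n⇒m≤1+n a≤i))) (f≗0 (suc i) ℕₚ.≤-refl)

  sumTo-+ : ∀ i (f g : ℕ → ℤ) → sumTo i (λ a → f a + g a) ≡ sumTo i f + sumTo i g
  sumTo-+ zero    f g = refl
  sumTo-+ (suc i) f g =
    trans (cong (_+ (f (suc i) + g (suc i))) (sumTo-+ i f g)) (swap (sumTo i f) (sumTo i g) _ _)
    where
    swap : ∀ (a b c d : ℤ) → a + b + (c + d) ≡ a + c + (b + d)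
    swap = solve-∀

  sumTo-- : ∀ i (f g : ℕ → ℤ) → sumTo i (λ a → f a - g a) ≡ sumTo i f - sumTo i g
  sumTo-- zero    f g = refl
  sumTo-- (suc i) f g =
    trans (cong (_+ (f (suc i) - g (suc i))) (sumTo-- i f g)) (swap (sumTo i f) (sumTo i g) _ _)
    where
    swap : ∀ (a b c d : ℤ) → a - b + (c - d) ≡ a + c - (b + d)
    swap = solve-∀

  sumTo-single : ∀ i k (f : ℕ → ℤ) → k ℕ.≤ i → (∀ a → a ℕ.≤ i → a ≢ k → f a ≡ + 0) → sumTo i f ≡ f k
  sumTo-single zero    .zero f z≤n f≗0 = refl
  sumTo-single (suc i) k     f k≤  f≗0 with k ℕ.≟ suc i
  ... | yes refl = trans (cong (_+ f (suc i)) (sumTo-zero i vanish)) (ℤₚ.+-identityˡ _)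
    where
    vanish : ∀ a → a ℕ.≤ i → f a ≡ + 0
    vanish a a≤i = f≗0 a (ℕₚ.m≤n⇒m≤1+n a≤i) (λ { refl → ℕₚ.<-irrefl refl (s≤s a≤i) })
  ... | no k≢ = trans (cong₂ _+_ (sumTo-single i k f k≤i (λ a a≤i → f≗0 a (ℕₚ.m≤n⇒m≤1+n a≤i)))
                                 (f≗0 (suc i) ℕₚ.≤-refl (k≢ ∘ sym)))
                      (ℤₚ.+-identityʳ _)
    where
    k≤i : k ℕ.≤ i
    k≤i = ℕₚ.≤-pred (ℕₚ.≤∧≢⇒< k≤ k≢)

  sumTo-suc : ∀ i (f : ℕ → ℤ) → sumTo (suc i) f ≡ f 0 + sumTo i (λ a → f (suc a))
  sumTo-suc zero    f = refl
  sumTo-suc (suc i) f = trans (cong (_+ f (suc (suc i))) (sumTo-suc i f)) (ℤₚ.+-assoc (f 0) _ _)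

  sumTo²-+ : ∀ i j (F G : ℕ → ℕ → ℤ) →
    sumTo i (λ a → sumTo j (λ b → F a b + G a b)) ≡
    sumTo i (λ a → sumTo j (F a)) + sumTo i (λ a → sumTo j (G a))
  sumTo²-+ i j F G = trans (sumTo-cong i (λ a _ → sumTo-+ j (F a) (G a))) (sumTo-+ i _ _)

  sumTo²-- : ∀ i j (F G : ℕ → ℕ → ℤ) →
    sumTo i (λ a → sumTo j (λ b → F a b - G a b)) ≡
    sumTo i (λ a → sumTo j (F a)) - sumTo i (λ a → sumTo j (G a))
  sumTo²-- i j F G = trans (sumTo-cong i (λ a _ → sumTo-- j (F a) (G a))) (sumTo-- i _ _)

  sumTo²-zero : ∀ i j (F : ℕ → ℕ → ℤ) → (∀ a b → a ℕ.≤ i → b ℕ.≤ j → F a b ≡ + 0) →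
    sumTo i (λ a → sumTo j (F a)) ≡ + 0
  sumTo²-zero i j F F≗0 = sumTo-zero i (λ a a≤i → sumTo-zero j (λ b b≤j → F≗0 a b a≤i b≤j))

  sumTo²-single : ∀ i j a₀ b₀ (F : ℕ → ℕ → ℤ) → a₀ ℕ.≤ i → b₀ ℕ.≤ j →
    (∀ a b → a ℕ.≤ i → b ℕ.≤ j → a ≢ a₀ ⊎ b ≢ b₀ → F a b ≡ + 0) →
    sumTo i (λ a → sumTo j (F a)) ≡ F a₀ b₀
  sumTo²-single i j a₀ b₀ F a₀≤i b₀≤j F≗0 =
    trans (sumTo-single i a₀ _ a₀≤i (λ a a≤i a≢ → sumTo-zero j (λ b b≤j → F≗0 a b a≤i b≤j (inj₁ a≢))))
          (sumTo-single j b₀ _ b₀≤j (λ b b≤j b≢ → F≗0 a₀ b a₀≤i b≤j (inj₂ b≢)))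

  mono-at : ∀ c a b → mono c a b a b ≡ c
  mono-at c a b with a ℕ.≟ a | b ℕ.≟ b
  ... | yes _  | yes _  = refl
  ... | no a≢a | _      = contradiction refl a≢a
  ... | yes _  | no b≢b = contradiction refl b≢b

  mono-off : ∀ c a b i j → i ≢ a ⊎ j ≢ b → mono c a b i j ≡ + 0
  mono-off c a b i j off with i ℕ.≟ a | j ℕ.≟ b
  ... | yes i≡a | yes j≡b = Sum.[ contradiction i≡a , contradiction j≡b ] off
  ... | yes _ | no _  = refl
  ... | no _  | yes _ = refl
  ... | no _  | no _  = refl

  mono⋆-shift : ∀ c a b (F : Series) i j → a ℕ.≤ i → b ℕ.≤ j →
    (mono c a b ⋆ F) i j ≡ c * F (i ∸ a) (j ∸ b)
  mono⋆-shift c a b F i j a≤i b≤j =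
    trans (sumTo²-single i j a b _ a≤i b≤j
            (λ a′ b′ _ _ off → cong (_* F (i ∸ a′) (j ∸ b′)) (mono-off c a b a′ b′ off)))
          (cong (_* F (i ∸ a) (j ∸ b)) (mono-at c a b))

  mono⋆-out : ∀ c a b (F : Series) i j → ¬ a ℕ.≤ i ⊎ ¬ b ℕ.≤ j → (mono c a b ⋆ F) i j ≡ + 0
  mono⋆-out c a b F i j out = sumTo²-zero i j _ (λ a′ b′ a′≤i b′≤j →
    cong (_* F (i ∸ a′) (j ∸ b′)) (mono-off c a b a′ b′
      (Sum.map (λ a≰i a′≡a → a≰i (subst (ℕ._≤ i) a′≡a a′≤i))
               (λ b≰j b′≡b → b≰j (subst (ℕ._≤ j) b′≡b b′≤j)) out)))

  ⋆-distribʳ-⊕ : ∀ (F G H : Series) i j → ((F ⊕ G) ⋆ H) i j ≡ (F ⋆ H) i j + (G ⋆ H) i j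
  ⋆-distribʳ-⊕ F G H i j =
    trans (sumTo-cong i (λ a _ → sumTo-cong j (λ b _ →
            ℤₚ.*-distribʳ-+ (H (i ∸ a) (j ∸ b)) (F a b) (G a b))))
          (sumTo²-+ i j _ _)

  ⋆-distribʳ-⊖ : ∀ (F G H : Series) i j → ((F ⊖ G) ⋆ H) i j ≡ (F ⋆ H) i j - (G ⋆ H) i j
  ⋆-distribʳ-⊖ F G H i j =
    trans (sumTo-cong i (λ a _ → sumTo-cong j (λ b _ →
            distrib (F a b) (G a b) (H (i ∸ a) (j ∸ b)))))
          (sumTo²-- i j _ _)
    where
    distrib : ∀ (x y z : ℤ) → (x - y) * z ≡ x * z - y * z
    distrib = solve-∀

module BallotNumbers where

  open import Data.Nat using (ℕ; zero; suc; _+_; _*_; _∸_; z≤n; _≤_; _<_; _≤?_)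
  open import Data.Nat.Properties
  open import Data.Nat.Tactic.RingSolver using (solve-∀)
  open import Relation.Nullary using (yes; no)
  open import Relation.Binary.PropositionalEquality

  double : ℕ → ℕ
  double zero    = zero
  double (suc n) = suc (suc (double n))

  double≡+ : ∀ n → double n ≡ n + n
  double≡+ zero    = refl
  double≡+ (suc n) = cong suc (trans (cong suc (double≡+ n)) (sym (+-suc n n)))

  double-∸ : ∀ m n → double m ∸ double n ≡ double (m ∸ n)
  double-∸ m       zero    = refl
  double-∸ zero    (suc n) = refl
  double-∸ (suc m) (suc n) = double-∸ m n

  -- ballot ℓ h counts the ±1 paths of length ℓ from height h down to height 0 that never go below 0.
  ballot : ℕ → ℕ → ℕ
  ballot zero    zero    = 1
  ballot zero    (suc _) = 0
  ballot (suc ℓ) zero    = ballot ℓ 1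
  ballot (suc ℓ) (suc h) = ballot ℓ h + ballot ℓ (suc (suc h))

  catalan : ℕ → ℕ
  catalan n = ballot (double n) 0

  mutual
    ballot-odd-even : ∀ n h → ballot (suc (double n)) (double h) ≡ 0
    ballot-odd-even n zero    = ballot-even-odd n zero
    ballot-odd-even n (suc h) = cong₂ _+_ (ballot-even-odd n h) (ballot-even-odd n (suc h))

    ballot-even-odd : ∀ n h → ballot (double n) (suc (double h)) ≡ 0
    ballot-even-odd zero    h = refl
    ballot-even-odd (suc n) h = cong₂ _+_ (ballot-odd-even n h) (ballot-odd-even n (suc h))

  -- The same recursion with a truncated length ℓ ∸ k; it survives the truncation because ballot 0 h = 0 for h > 0.
  ballot-step : ∀ ℓ k h → k ≤ h → ballot (suc ℓ ∸ k) (suc h) ≡ ballot (ℓ ∸ k) h + ballot (ℓ ∸ k) (suc (suc h))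
  ballot-step ℓ k h k≤h with k ≤? ℓ
  ... | yes k≤ℓ rewrite +-∸-assoc 1 k≤ℓ = refl
  ... | no  k≰ℓ rewrite m≤n⇒m∸n≡0 (≰⇒≥ k≰ℓ) | m≤n⇒m∸n≡0 (≰⇒> k≰ℓ) =
    positive h (<-≤-trans (≤-<-trans z≤n (≰⇒> k≰ℓ)) k≤h)
    where
    positive : ∀ h → 0 < h → 0 ≡ ballot 0 h + 0
    positive (suc h) _ = refl

  sumToℕ : ℕ → (ℕ → ℕ) → ℕ
  sumToℕ zero    f = f 0
  sumToℕ (suc i) f = sumToℕ i f + f (suc i)

  sumToℕ-cong : ∀ i {f g : ℕ → ℕ} → (∀ a → a ≤ i → f a ≡ g a) → sumToℕ i f ≡ sumToℕ i g
  sumToℕ-cong zero    f≗g = f≗g 0 z≤n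
  sumToℕ-cong (suc i) f≗g = cong₂ _+_ (sumToℕ-cong i (λ a a≤i → f≗g a (m≤n⇒m≤1+n a≤i))) (f≗g (suc i) ≤-refl)

  sumToℕ-+ : ∀ i (f g : ℕ → ℕ) → sumToℕ i (λ a → f a + g a) ≡ sumToℕ i f + sumToℕ i g
  sumToℕ-+ zero    f g = refl
  sumToℕ-+ (suc i) f g = trans (cong (_+ (f (suc i) + g (suc i))) (sumToℕ-+ i f g)) (swap (sumToℕ i f) (sumToℕ i g) _ _)
    where
    swap : ∀ a b c d → a + b + (c + d) ≡ a + c + (b + d)
    swap = solve-∀

  sumToℕ-*ˡ : ∀ i c (f : ℕ → ℕ) → sumToℕ i (λ a → c * f a) ≡ c * sumToℕ i f
  sumToℕ-*ˡ zero    c f = refl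
  sumToℕ-*ˡ (suc i) c f = trans (cong (_+ c * f (suc i)) (sumToℕ-*ˡ i c f)) (sym (*-distribˡ-+ c _ _))

  sumToℕ-double : ∀ n (f : ℕ → ℕ) → (∀ a → f (suc (double a)) ≡ 0) →
                  sumToℕ (double n) f ≡ sumToℕ n (λ a → f (double a))
  sumToℕ-double zero    f odd≗0 = refl
  sumToℕ-double (suc n) f odd≗0 rewrite sumToℕ-double n f odd≗0 | odd≗0 n = cong (_+ f (double (suc n))) (+-identityʳ _)

  -- Split a path from height h + 1 at its first visit to height h: an excursion of length a lifted to height h + 1,
  -- a down step, and a path from height h.
  ballot-firstPassage : ∀ ℓ h → ballot (suc ℓ) (suc h) ≡ sumToℕ ℓ (λ a → ballot a 0 * ballot (ℓ ∸ a) h)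
  ballot-firstPassage zero    zero    = refl
  ballot-firstPassage zero    (suc h) = refl
  ballot-firstPassage (suc ℓ) h       = begin
    ballot (suc (suc ℓ)) (suc h)
      ≡⟨ ballot-split h ⟩
    sumToℕ ℓ (λ a → ballot a 0 * ballot (suc ℓ ∸ a) h) + ballot (suc ℓ) 0 * ballot 0 h
      ≡⟨ cong (λ z → sumToℕ ℓ (λ a → ballot a 0 * ballot (suc ℓ ∸ a) h) + ballot (suc ℓ) 0 * ballot z h)
              (sym (n∸n≡0 ℓ)) ⟩
    sumToℕ (suc ℓ) (λ a → ballot a 0 * ballot (suc ℓ ∸ a) h) ∎
    where
    open ≡-Reasoning
    lastStep : ∀ h′ h → (∀ a → a ≤ ℓ → ballot (ℓ ∸ a) h′ ≡ ballot (suc ℓ ∸ a) h) →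
               sumToℕ ℓ (λ a → ballot a 0 * ballot (ℓ ∸ a) h′) ≡ sumToℕ ℓ (λ a → ballot a 0 * ballot (suc ℓ ∸ a) h)
    lastStep h′ h eq = sumToℕ-cong ℓ (λ a a≤ℓ → cong (ballot a 0 *_) (eq a a≤ℓ))
    ballot-split : ∀ h → ballot (suc (suc ℓ)) (suc h) ≡
                   sumToℕ ℓ (λ a → ballot a 0 * ballot (suc ℓ ∸ a) h) + ballot (suc ℓ) 0 * ballot 0 h
    ballot-split zero = begin
      ballot (suc ℓ) 0 + ballot (suc ℓ) 2
        ≡⟨ cong (ballot (suc ℓ) 0 +_) (ballot-firstPassage ℓ 1) ⟩
      ballot (suc ℓ) 0 + sumToℕ ℓ (λ a → ballot a 0 * ballot (ℓ ∸ a) 1)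
        ≡⟨ +-comm (ballot (suc ℓ) 0) _ ⟩
      sumToℕ ℓ (λ a → ballot a 0 * ballot (ℓ ∸ a) 1) + ballot (suc ℓ) 0
        ≡⟨ cong₂ _+_ (lastStep 1 0 (λ a a≤ℓ → cong (λ z → ballot z 0) (sym (+-∸-assoc 1 a≤ℓ))))
                     (sym (*-identityʳ (ballot (suc ℓ) 0))) ⟩
      sumToℕ ℓ (λ a → ballot a 0 * ballot (suc ℓ ∸ a) 0) + ballot (suc ℓ) 0 * 1 ∎
    ballot-split (suc h) = begin
      ballot (suc ℓ) (suc h) + ballot (suc ℓ) (suc (suc (suc h)))
        ≡⟨ cong₂ _+_ (ballot-firstPassage ℓ h) (ballot-firstPassage ℓ (suc (suc h))) ⟩
      sumToℕ ℓ (λ a → ballot a 0 * ballot (ℓ ∸ a) h) + sumToℕ ℓ (λ a → ballot a 0 * ballot (ℓ ∸ a) (suc (suc h)))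
        ≡⟨ sym (sumToℕ-+ ℓ _ _) ⟩
      sumToℕ ℓ (λ a → ballot a 0 * ballot (ℓ ∸ a) h + ballot a 0 * ballot (ℓ ∸ a) (suc (suc h)))
        ≡⟨ sumToℕ-cong ℓ (λ a a≤ℓ → trans (sym (*-distribˡ-+ (ballot a 0) _ _))
                                         (cong (λ z → ballot a 0 * ballot z (suc h)) (sym (+-∸-assoc 1 a≤ℓ)))) ⟩
      sumToℕ ℓ (λ a → ballot a 0 * ballot (suc ℓ ∸ a) (suc h))
        ≡⟨ sym (trans (cong (sumToℕ ℓ (λ a → ballot a 0 * ballot (suc ℓ ∸ a) (suc h)) +_) (*-zeroʳ (ballot (suc ℓ) 0)))
                      (+-identityʳ _)) ⟩
      sumToℕ ℓ (λ a → ballot a 0 * ballot (suc ℓ ∸ a) (suc h)) + ballot (suc ℓ) 0 * 0 ∎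

  catalan-convolution : ∀ n → sumToℕ n (λ a → catalan a * catalan (n ∸ a)) ≡ catalan (suc n)
  catalan-convolution n = sym (begin
    ballot (suc (double n)) 1
      ≡⟨ ballot-firstPassage (double n) 0 ⟩
    sumToℕ (double n) (λ a → ballot a 0 * ballot (double n ∸ a) 0)
      ≡⟨ sumToℕ-double n _ (λ a → cong (_* ballot (double n ∸ suc (double a)) 0) (ballot-odd-even a 0)) ⟩
    sumToℕ n (λ a → ballot (double a) 0 * ballot (double n ∸ double a) 0)
      ≡⟨ sumToℕ-cong n (λ a _ → cong (λ z → ballot (double a) 0 * ballot z 0) (double-∸ n a)) ⟩
    sumToℕ n (λ a → catalan a * catalan (n ∸ a)) ∎)
    where open ≡-Reasoning

module SquareRoot where

  open import Defs
  open PowerSeries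
  open BallotNumbers using (catalan; catalan-convolution; sumToℕ; sumToℕ-*ˡ)
  open import Data.Nat as ℕ using (ℕ; zero; suc; _∸_; z≤n; s≤s)
  import Data.Nat.Properties as ℕₚ
  open import Data.Integer using (ℤ; +_; _+_; _*_; _-_; -_)
  import Data.Integer.Properties as ℤₚ
  open import Data.Integer.Tactic.RingSolver using (solve-∀)
  open import Data.Sum using (_⊎_; inj₁; inj₂)
  import Data.Sum as Sum
  open import Relation.Nullary using (contradiction)
  open import Relation.Binary.PropositionalEquality

  module _ {S T : Series} (S₀ : S 0 0 ≡ + 1) (T₀ : T 0 0 ≡ + 1) (S²≈T² : (S ⋆ S) ≈ₛ (T ⋆ T)) where

    private
      ∸≡⇒≡0 : ∀ {i a} → a ℕ.≤ i → i ∸ a ≡ i → a ≡ 0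
      ∸≡⇒≡0 {i}     {zero}  _         _   = refl
      ∸≡⇒≡0 {suc i} {suc a} (s≤s a≤i) eq = contradiction (subst (ℕ._≤ i) eq (ℕₚ.m∸n≤m i a)) (ℕₚ.<-irrefl refl)

      -- If S and T agree below (i, j), the (i, j) coefficients of S² and T² differ by 2 (S i j - T i j).
      agree-at : ∀ i j → (∀ a b → a ℕ.≤ i → b ℕ.≤ j → a ≢ i ⊎ b ≢ j → S a b ≡ T a b) → S i j ≡ T i j
      agree-at i j below = ℤₚ.i-j≡0⇒i≡j _ _ (ℤₚ.*-cancelˡ-≡ (+ 2) d (+ 0) 2d≡0)
        where
        d : ℤ
        d = S i j - T i j
        Sᶜ Tᶜ : ℕ → ℕ → ℤ
        Sᶜ a b = S (i ∸ a) (j ∸ b)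
        Tᶜ a b = T (i ∸ a) (j ∸ b)
        diff≡0 : ∀ a b → S a b ≡ T a b → S a b - T a b ≡ + 0
        diff≡0 a b eq = trans (cong (_- T a b) eq) (ℤₚ.+-inverseʳ (T a b))
        leftFactor : sumTo i (λ a → sumTo j (λ b → (S a b - T a b) * Sᶜ a b)) ≡ d * + 1
        leftFactor =
          trans (sumTo²-single i j i j _ ℕₚ.≤-refl ℕₚ.≤-refl
                  (λ a b a≤i b≤j off → cong (_* Sᶜ a b) (diff≡0 a b (below a b a≤i b≤j off))))
                (cong (d *_) (trans (cong₂ S (ℕₚ.n∸n≡0 i) (ℕₚ.n∸n≡0 j)) S₀))
        rightFactor : sumTo i (λ a → sumTo j (λ b → T a b * (Sᶜ a b - Tᶜ a b))) ≡ + 1 * d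
        rightFactor =
          trans (sumTo²-single i j 0 0 _ z≤n z≤n
                  (λ a b a≤i b≤j off → trans (cong (T a b *_) (diff≡0 (i ∸ a) (j ∸ b)
                     (below (i ∸ a) (j ∸ b) (ℕₚ.m∸n≤m i a) (ℕₚ.m∸n≤m j b)
                        (Sum.map (λ a≢0 eq → a≢0 (∸≡⇒≡0 a≤i eq)) (λ b≢0 eq → b≢0 (∸≡⇒≡0 b≤j eq)) off))))
                     (ℤₚ.*-zeroʳ (T a b))))
                (cong (_* d) T₀)
        split : ∀ (s t s′ t′ : ℤ) → s * s′ - t * t′ ≡ (s - t) * s′ + t * (s′ - t′)
        split = solve-∀
        double : ∀ (x : ℤ) → + 2 * x ≡ x * + 1 + + 1 * x
        double = solve-∀
        2d≡0 : + 2 * d ≡ + 0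
        2d≡0 = begin
          + 2 * d
            ≡⟨ double d ⟩
          d * + 1 + + 1 * d
            ≡⟨ sym (cong₂ _+_ leftFactor rightFactor) ⟩
          sumTo i (λ a → sumTo j (λ b → (S a b - T a b) * Sᶜ a b)) + sumTo i (λ a → sumTo j (λ b → T a b * (Sᶜ a b - Tᶜ a b)))
            ≡⟨ sym (sumTo²-+ i j _ _) ⟩
          sumTo i (λ a → sumTo j (λ b → (S a b - T a b) * Sᶜ a b + T a b * (Sᶜ a b - Tᶜ a b)))
            ≡⟨ sumTo-cong i (λ a _ → sumTo-cong j (λ b _ → sym (split (S a b) (T a b) (Sᶜ a b) (Tᶜ a b)))) ⟩
          sumTo i (λ a → sumTo j (λ b → S a b * Sᶜ a b - T a b * Tᶜ a b))
            ≡⟨ sumTo²-- i j _ _ ⟩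
          (S ⋆ S) i j - (T ⋆ T) i j
            ≡⟨ cong (_- (T ⋆ T) i j) (S²≈T² i j) ⟩
          (T ⋆ T) i j - (T ⋆ T) i j
            ≡⟨ ℤₚ.+-inverseʳ ((T ⋆ T) i j) ⟩
          + 0 ∎
          where open ≡-Reasoning

      agree-below : ∀ n i j → i ℕ.+ j ℕ.< n → S i j ≡ T i j
      agree-below (suc n) i j (s≤s i+j≤n) =
        agree-at i j (λ a b a≤i b≤j off → agree-below n a b (ℕₚ.<-≤-trans (smaller a≤i b≤j off) i+j≤n))
        where
        smaller : ∀ {a b} → a ℕ.≤ i → b ℕ.≤ j → a ≢ i ⊎ b ≢ j → a ℕ.+ b ℕ.< i ℕ.+ j
        smaller a≤i b≤j (inj₁ a≢i) = ℕₚ.+-mono-<-≤ (ℕₚ.≤∧≢⇒< a≤i a≢i) b≤j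
        smaller a≤i b≤j (inj₂ b≢j) = ℕₚ.+-mono-≤-< a≤i (ℕₚ.≤∧≢⇒< b≤j b≢j)

    ⋆-square-injective : S ≈ₛ T
    ⋆-square-injective i j = agree-below (suc (i ℕ.+ j)) i j ℕₚ.≤-refl

  -- √(1 - 4t) = 1 - 2 ∑ₙ catalan n · t^(n+1)
  catalanRoot : Series
  catalanRoot zero    zero    = + 1
  catalanRoot zero    (suc n) = - (+ (2 ℕ.* catalan n))
  catalanRoot (suc i) j       = + 0

  catalanRoot-squared : (catalanRoot ⋆ catalanRoot) ≈ₛ oneMinus4t
  catalanRoot-squared (suc i) j = sumTo²-zero (suc i) j _ λ where
    zero    b _ _ → ℤₚ.*-zeroʳ (catalanRoot 0 b)
    (suc a) b _ _ → refl
  catalanRoot-squared zero zero          = refl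
  catalanRoot-squared zero (suc zero)    = refl
  catalanRoot-squared zero (suc (suc n)) = begin
    sumTo (suc (suc n)) g
      ≡⟨ cong (_+ g (suc (suc n))) (sumTo-suc n g) ⟩
    g 0 + sumTo n (λ b → g (suc b)) + g (suc (suc n))
      ≡⟨ cong₂ (λ u v → g 0 + u + v) inner outer ⟩
    g 0 + + (4 ℕ.* C) + - (+ (2 ℕ.* C)) * + 1
      ≡⟨ cancel C ⟩
    + 0 ∎
    where
    open ≡-Reasoning
    C : ℕ
    C = catalan (suc n)
    g : ℕ → ℤ
    g b = catalanRoot 0 b * catalanRoot 0 (suc (suc n) ∸ b)
    outer : g (suc (suc n)) ≡ - (+ (2 ℕ.* C)) * + 1
    outer = cong (λ z → - (+ (2 ℕ.* C)) * catalanRoot 0 z) (ℕₚ.n∸n≡0 n)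
    product : ∀ x y → - (+ (2 ℕ.* x)) * - (+ (2 ℕ.* y)) ≡ + (4 ℕ.* (x ℕ.* y))
    product x y = begin
      - (+ (2 ℕ.* x)) * - (+ (2 ℕ.* y)) ≡⟨ cong₂ (λ u v → - u * - v) (ℤₚ.pos-* 2 x) (ℤₚ.pos-* 2 y) ⟩
      - (+ 2 * + x) * - (+ 2 * + y)     ≡⟨ solved (+ x) (+ y) ⟩
      + 4 * (+ x * + y)                 ≡⟨ cong (+ 4 *_) (sym (ℤₚ.pos-* x y)) ⟩
      + 4 * + (x ℕ.* y)                 ≡⟨ sym (ℤₚ.pos-* 4 (x ℕ.* y)) ⟩
      + (4 ℕ.* (x ℕ.* y))               ∎
      where
      solved : ∀ (x y : ℤ) → - (+ 2 * x) * - (+ 2 * y) ≡ + 4 * (x * y)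
      solved = solve-∀
    sumTo-pos : ∀ i (f : ℕ → ℕ) → sumTo i (λ a → + f a) ≡ + sumToℕ i f
    sumTo-pos zero    f = refl
    sumTo-pos (suc i) f = cong (_+ + f (suc i)) (sumTo-pos i f)
    inner : sumTo n (λ b → g (suc b)) ≡ + (4 ℕ.* C)
    inner = begin
      sumTo n (λ b → g (suc b))
        ≡⟨ sumTo-cong n (λ b b≤n → trans (cong (λ z → catalanRoot 0 (suc b) * catalanRoot 0 z) (ℕₚ.+-∸-assoc 1 b≤n))
                                          (product (catalan b) (catalan (n ∸ b)))) ⟩
      sumTo n (λ b → + (4 ℕ.* (catalan b ℕ.* catalan (n ∸ b))))
        ≡⟨ sumTo-pos n _ ⟩
      + sumToℕ n (λ b → 4 ℕ.* (catalan b ℕ.* catalan (n ∸ b)))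
        ≡⟨ cong +_ (sumToℕ-*ˡ n 4 _) ⟩
      + (4 ℕ.* sumToℕ n (λ b → catalan b ℕ.* catalan (n ∸ b)))
        ≡⟨ cong (λ z → + (4 ℕ.* z)) (catalan-convolution n) ⟩
      + (4 ℕ.* C) ∎
    cancel : ∀ c → + 1 * - (+ (2 ℕ.* c)) + + (4 ℕ.* c) + - (+ (2 ℕ.* c)) * + 1 ≡ + 0
    cancel c = trans (cong₂ (λ u v → + 1 * - u + v + - u * + 1) (ℤₚ.pos-* 2 c) (ℤₚ.pos-* 4 c)) (solved (+ c))
      where
      solved : ∀ (x : ℤ) → + 1 * - (+ 2 * x) + + 4 * x + - (+ 2 * x) * + 1 ≡ + 0
      solved = solve-∀

  sqrt-oneMinus4t : ∀ {S} → S 0 0 ≡ + 1 → (S ⋆ S) ≈ₛ oneMinus4t → S ≈ₛ catalanRoot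
  sqrt-oneMinus4t S₀ S² = ⋆-square-injective S₀ refl (λ i j → trans (S² i j) (sym (catalanRoot-squared i j)))

module GeneratingFunction where

  open import Defs
  open PowerSeries
  open BallotNumbers using (ballot; double; catalan; ballot-step)
  open SquareRoot using (catalanRoot; sqrt-oneMinus4t)
  open import Data.Nat as ℕ using (ℕ; zero; suc; _∸_; z≤n; s≤s)
  import Data.Nat.Properties as ℕₚ
  open import Data.Integer using (ℤ; +_; _+_; _*_; _-_; -_)
  import Data.Integer.Properties as ℤₚ
  open import Data.Integer.Tactic.RingSolver using (solve-∀)
  open import Data.Sum using (inj₁; inj₂)
  open import Relation.Binary.PropositionalEquality

  private
    2x⋆_ : Series → ℕ → ℕ → ℤ
    (2x⋆ F) i j = (mono (+ 2) 1 0 ⋆ F) i j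

    2x²t⋆_ : Series → ℕ → ℕ → ℤ
    (2x²t⋆ F) i j = (mono (+ 2) 2 1 ⋆ F) i j

  denom⋆-split : ∀ (F : Series) i j → (denom ⋆ F) i j ≡ + 2 * F i j - (2x⋆ F) i j + (2x²t⋆ F) i j
  denom⋆-split F i j = begin
    (denom ⋆ F) i j
      ≡⟨ ⋆-distribʳ-⊕ (mono (+ 2) 0 0 ⊖ mono (+ 2) 1 0) (mono (+ 2) 2 1) F i j ⟩
    ((mono (+ 2) 0 0 ⊖ mono (+ 2) 1 0) ⋆ F) i j + (2x²t⋆ F) i j
      ≡⟨ cong (_+ (2x²t⋆ F) i j) (⋆-distribʳ-⊖ (mono (+ 2) 0 0) (mono (+ 2) 1 0) F i j) ⟩
    (mono (+ 2) 0 0 ⋆ F) i j - (2x⋆ F) i j + (2x²t⋆ F) i j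
      ≡⟨ cong (λ u → u - (2x⋆ F) i j + (2x²t⋆ F) i j) (mono⋆-shift (+ 2) 0 0 F i j z≤n z≤n) ⟩
    + 2 * F i j - (2x⋆ F) i j + (2x²t⋆ F) i j ∎
    where open ≡-Reasoning

  denom⋆-x⁰ : ∀ (F : Series) j → (denom ⋆ F) 0 j ≡ + 2 * F 0 j - + 0 + + 0
  denom⋆-x⁰ F j = trans (denom⋆-split F 0 j) (cong₂ (λ u v → + 2 * F 0 j - u + v)
    (mono⋆-out (+ 2) 1 0 F 0 j (inj₁ λ ())) (mono⋆-out (+ 2) 2 1 F 0 j (inj₁ λ ())))

  denom⋆-x¹ : ∀ (F : Series) j → (denom ⋆ F) 1 j ≡ + 2 * F 1 j - + 2 * F 0 j + + 0
  denom⋆-x¹ F j = trans (denom⋆-split F 1 j) (cong₂ (λ u v → + 2 * F 1 j - u + v)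
    (mono⋆-shift (+ 2) 1 0 F 1 j (s≤s z≤n) z≤n) (mono⋆-out (+ 2) 2 1 F 1 j (inj₁ λ { (s≤s ()) })))

  denom⋆-t⁰ : ∀ (F : Series) i → (denom ⋆ F) (2 ℕ.+ i) 0 ≡ + 2 * F (2 ℕ.+ i) 0 - + 2 * F (1 ℕ.+ i) 0 + + 0
  denom⋆-t⁰ F i = trans (denom⋆-split F (2 ℕ.+ i) 0) (cong₂ (λ u v → + 2 * F (2 ℕ.+ i) 0 - u + v)
    (mono⋆-shift (+ 2) 1 0 F (2 ℕ.+ i) 0 (s≤s z≤n) z≤n) (mono⋆-out (+ 2) 2 1 F (2 ℕ.+ i) 0 (inj₂ λ ())))

  denom⋆-x²t : ∀ (F : Series) i j →
    (denom ⋆ F) (2 ℕ.+ i) (suc j) ≡ + 2 * F (2 ℕ.+ i) (suc j) - + 2 * F (1 ℕ.+ i) (suc j) + + 2 * F i j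
  denom⋆-x²t F i j = trans (denom⋆-split F (2 ℕ.+ i) (suc j)) (cong₂ (λ u v → + 2 * F (2 ℕ.+ i) (suc j) - u + v)
    (mono⋆-shift (+ 2) 1 0 F (2 ℕ.+ i) (suc j) (s≤s z≤n) z≤n)
    (mono⋆-shift (+ 2) 2 1 F (2 ℕ.+ i) (suc j) (s≤s (s≤s z≤n)) (s≤s z≤n)))

  numer-x⁰ : ∀ S j → numer S 0 j ≡ + 0
  numer-x⁰ S j = cong (_-_ (+ 0 - + 0)) (mono⋆-out (+ 1) 1 0 S 0 j (inj₁ λ ()))

  numer-suc : ∀ S i j → numer S (suc i) j ≡ mono (+ 1) 1 0 (suc i) j - mono (+ 2) 2 1 (suc i) j - S i j
  numer-suc S i j = cong (_-_ (mono (+ 1) 1 0 (suc i) j - mono (+ 2) 2 1 (suc i) j))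
    (trans (mono⋆-shift (+ 1) 1 0 S (suc i) j (s≤s z≤n) z≤n) (ℤₚ.*-identityˡ (S i j)))

  module _ (c : ℕ → ℕ → ℕ)
           (c-ballot : ∀ L k → c (suc L) (suc k) ≡ ballot (double L ∸ k) k)
           (c-zero : ∀ L → c (suc L) 0 ≡ 0) where

    private
      G : Series
      G = genSeries c

      G-x⁰ : ∀ j → G 0 j ≡ + 0
      G-x⁰ zero    = refl
      G-x⁰ (suc L) = cong +_ (c-zero L)

      -- The coefficients of x² t G, x G and G cancel except at x² t, which is where the term -2x²t of the numerator comes from.
      G-recurrence : ∀ i j → 0 ℕ.< i ℕ.+ j → G (2 ℕ.+ i) (suc j) + G i j ≡ G (1 ℕ.+ i) (suc j)
      G-recurrence zero (suc L) _ rewrite c-ballot (suc L) 1 | c-zero L | c-ballot (suc L) 0 = ℤₚ.+-identityʳ _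
      G-recurrence (suc k) zero _ rewrite c-ballot 0 (2 ℕ.+ k) | c-ballot 0 (1 ℕ.+ k) = refl
      G-recurrence (suc k) (suc L) _ rewrite c-ballot (suc L) (2 ℕ.+ k) | c-ballot L k | c-ballot (suc L) (1 ℕ.+ k) =
        trans (sym (ℤₚ.pos-+ (ballot (double L ∸ k) (2 ℕ.+ k)) (ballot (double L ∸ k) k)))
              (cong +_ (trans (ℕₚ.+-comm (ballot (double L ∸ k) (2 ℕ.+ k)) _) (sym (ballot-step (double L) k k ℕₚ.≤-refl))))

      G-cancel : ∀ i j → 0 ℕ.< i ℕ.+ j → + 2 * G (2 ℕ.+ i) (suc j) - + 2 * G (1 ℕ.+ i) (suc j) + + 2 * G i j ≡ + 0
      G-cancel i j 0<i+j = begin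
        + 2 * G (2 ℕ.+ i) (suc j) - + 2 * G (1 ℕ.+ i) (suc j) + + 2 * G i j
          ≡⟨ cong (λ g → + 2 * G (2 ℕ.+ i) (suc j) - + 2 * g + + 2 * G i j) (sym (G-recurrence i j 0<i+j)) ⟩
        + 2 * G (2 ℕ.+ i) (suc j) - + 2 * (G (2 ℕ.+ i) (suc j) + G i j) + + 2 * G i j
          ≡⟨ solved (G (2 ℕ.+ i) (suc j)) (G i j) ⟩
        + 0 ∎
        where
        open ≡-Reasoning
        solved : ∀ (a d : ℤ) → + 2 * a - + 2 * (a + d) + + 2 * d ≡ + 0
        solved = solve-∀

    denom⋆genSeries≈numer : ∀ {S} → S 0 0 ≡ + 1 → (S ⋆ S) ≈ₛ oneMinus4t → (denom ⋆ genSeries c) ≈ₛ numer S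
    denom⋆genSeries≈numer {S} S₀ S² = coeff
      where
      S≈root : S ≈ₛ catalanRoot
      S≈root = sqrt-oneMinus4t S₀ S²

      coeff : (denom ⋆ G) ≈ₛ numer S
      coeff zero j = trans (denom⋆-x⁰ G j) (trans (cong (λ g → + 2 * g - + 0 + + 0) (G-x⁰ j)) (sym (numer-x⁰ S j)))
      coeff 1 zero = trans (denom⋆-x¹ G 0) (sym (trans (numer-suc S 0 0) (cong (_-_ (+ 1 - + 0)) S₀)))
      coeff 1 (suc L) = begin
        (denom ⋆ G) 1 (suc L)
          ≡⟨ denom⋆-x¹ G (suc L) ⟩
        + 2 * + c (suc L) 1 - + 2 * G 0 (suc L) + + 0
          ≡⟨ cong₂ (λ u v → + 2 * + u - + 2 * v + + 0) (c-ballot L 0) (G-x⁰ (suc L)) ⟩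
        + 2 * + catalan L - + 2 * + 0 + + 0
          ≡⟨ cong (λ u → u - + 2 * + 0 + + 0) (sym (ℤₚ.pos-* 2 (catalan L))) ⟩
        + (2 ℕ.* catalan L) - + 2 * + 0 + + 0
          ≡⟨ solved (+ (2 ℕ.* catalan L)) ⟩
        + 0 - + 0 - - (+ (2 ℕ.* catalan L))
          ≡⟨ cong (_-_ (+ 0 - + 0)) (sym (S≈root 0 (suc L))) ⟩
        + 0 - + 0 - S 0 (suc L)
          ≡⟨ sym (numer-suc S 0 (suc L)) ⟩
        numer S 1 (suc L) ∎
        where
        open ≡-Reasoning
        solved : ∀ (x : ℤ) → x - + 2 * + 0 + + 0 ≡ + 0 - + 0 - - x
        solved = solve-∀
      coeff (suc (suc i)) zero = trans (denom⋆-t⁰ G i) (sym (trans (numer-suc S (suc i) 0)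
        (cong₂ (λ u v → + 0 - u - v) (mono-off (+ 2) 2 1 (2 ℕ.+ i) 0 (inj₂ λ ())) (S≈root (suc i) 0))))
      coeff 2 1 = trans (denom⋆-x²t G 0 0)
        (trans (cong₂ (λ u v → + 2 * + u - + 2 * + v + + 2 * + 0) (c-ballot 0 1) (c-ballot 0 0))
        (sym (trans (numer-suc S 1 1) (cong (_-_ (+ 0 - + 2)) (S≈root 1 1)))))
      coeff 2 (suc (suc L)) = trans (denom⋆-x²t G 0 (suc L)) (trans (G-cancel 0 (suc L) (s≤s z≤n))
        (sym (trans (numer-suc S 1 (suc (suc L))) (cong (_-_ (+ 0 - + 0)) (S≈root 1 (suc (suc L)))))))
      coeff (suc (suc (suc i))) (suc j) = trans (denom⋆-x²t G (suc i) j) (trans (G-cancel (suc i) j (s≤s z≤n))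
        (sym (trans (numer-suc S (2 ℕ.+ i) (suc j)) (cong (_-_ (+ 0 - + 0)) (S≈root (2 ℕ.+ i) (suc j))))))

module MotzkinPaths where

  open import Data.Nat using (ℕ; zero; suc; _+_; _∸_; _≤_)
  open import Data.Nat.Properties using (≤-refl; ≤-trans; n≤1+n; m≤n+m)
  open import Data.Fin using (Fin)
  import Data.Fin as Fin
  open import Data.Fin.Properties using (+↔⊎; 0↔⊥)
  open import Data.Empty using (⊥)
  open import Data.Product using (Σ; _,_)
  open import Data.Sum using (_⊎_; inj₁; inj₂)
  open import Data.Sum.Function.Propositional using (_⊎-↔_)
  open import Function.Bundles using (_↔_; mk↔ₛ′)
  open import Function.Properties.Inverse using (↔-sym; ↔-trans)
  open import Relation.Nullary using (contradiction)
  open import Relation.Binary.PropositionalEquality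
  open BallotNumbers using (ballot; double; ballot-step)

  -- Motzkin L h k: paths of L steps from height h down to height 0, with two kinds of level step
  -- (level and level′); k counts the level′ steps taken at height 0.
  data Motzkin : ℕ → ℕ → ℕ → Set where
    end     : Motzkin 0 0 0
    level   : ∀ {L h k} → Motzkin L h k → Motzkin (suc L) h k
    rise    : ∀ {L h k} → Motzkin L (suc h) k → Motzkin (suc L) h k
    fall    : ∀ {L h k} → Motzkin L h k → Motzkin (suc L) (suc h) k
    level′  : ∀ {L h k} → Motzkin L (suc h) k → Motzkin (suc L) (suc h) k
    level′₀ : ∀ {L k} → Motzkin L 0 k → Motzkin (suc L) 0 (suc k)

  cons-level : ∀ {L h} → Σ ℕ (Motzkin L h) → Σ ℕ (Motzkin (suc L) h)
  cons-level (k , p) = k , level p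

  cons-rise : ∀ {L h} → Σ ℕ (Motzkin L (suc h)) → Σ ℕ (Motzkin (suc L) h)
  cons-rise (k , p) = k , rise p

  cons-fall : ∀ {L h} → Σ ℕ (Motzkin L h) → Σ ℕ (Motzkin (suc L) (suc h))
  cons-fall (k , p) = k , fall p

  cons-level′ : ∀ {L h} → Σ ℕ (Motzkin L (suc h)) → Σ ℕ (Motzkin (suc L) (suc h))
  cons-level′ (k , p) = k , level′ p

  cons-level′₀ : ∀ {L} → Σ ℕ (Motzkin L 0) → Σ ℕ (Motzkin (suc L) 0)
  cons-level′₀ (k , p) = suc k , level′₀ p

  motzkinCount : ℕ → ℕ → ℕ → ℕ
  motzkinCount zero    zero    zero    = 1
  motzkinCount zero    zero    (suc k) = 0
  motzkinCount zero    (suc h) k       = 0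
  motzkinCount (suc L) zero    zero    = motzkinCount L 0 0 + motzkinCount L 1 0
  motzkinCount (suc L) zero    (suc k) = motzkinCount L 0 k + (motzkinCount L 0 (suc k) + motzkinCount L 1 (suc k))
  motzkinCount (suc L) (suc h) k       =
    (motzkinCount L h k + motzkinCount L (suc h) k) + (motzkinCount L (suc h) k + motzkinCount L (suc (suc h)) k)

  private
    firstStep-0-0 : ∀ {L} → Motzkin (suc L) 0 0 ↔ (Motzkin L 0 0 ⊎ Motzkin L 1 0)
    firstStep-0-0 = mk↔ₛ′ to from (λ { (inj₁ _) → refl ; (inj₂ _) → refl }) (λ { (level _) → refl ; (rise _) → refl })
      where
      to : ∀ {L} → Motzkin (suc L) 0 0 → Motzkin L 0 0 ⊎ Motzkin L 1 0
      to (level p) = inj₁ p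
      to (rise p)  = inj₂ p
      from : ∀ {L} → Motzkin L 0 0 ⊎ Motzkin L 1 0 → Motzkin (suc L) 0 0
      from (inj₁ p) = level p
      from (inj₂ p) = rise p

    firstStep-0-suc : ∀ {L k} → Motzkin (suc L) 0 (suc k) ↔ (Motzkin L 0 k ⊎ (Motzkin L 0 (suc k) ⊎ Motzkin L 1 (suc k)))
    firstStep-0-suc = mk↔ₛ′ to from (λ { (inj₁ _) → refl ; (inj₂ (inj₁ _)) → refl ; (inj₂ (inj₂ _)) → refl })
                                    (λ { (level _) → refl ; (rise _) → refl ; (level′₀ _) → refl })
      where
      to : ∀ {L k} → Motzkin (suc L) 0 (suc k) → Motzkin L 0 k ⊎ (Motzkin L 0 (suc k) ⊎ Motzkin L 1 (suc k))
      to (level′₀ p) = inj₁ p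
      to (level p)   = inj₂ (inj₁ p)
      to (rise p)    = inj₂ (inj₂ p)
      from : ∀ {L k} → Motzkin L 0 k ⊎ (Motzkin L 0 (suc k) ⊎ Motzkin L 1 (suc k)) → Motzkin (suc L) 0 (suc k)
      from (inj₁ p)        = level′₀ p
      from (inj₂ (inj₁ p)) = level p
      from (inj₂ (inj₂ p)) = rise p

    firstStep-suc : ∀ {L h k} → Motzkin (suc L) (suc h) k ↔
      ((Motzkin L h k ⊎ Motzkin L (suc h) k) ⊎ (Motzkin L (suc h) k ⊎ Motzkin L (suc (suc h)) k))
    firstStep-suc = mk↔ₛ′ to from
      (λ { (inj₁ (inj₁ _)) → refl ; (inj₁ (inj₂ _)) → refl ; (inj₂ (inj₁ _)) → refl ; (inj₂ (inj₂ _)) → refl })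
      (λ { (level _) → refl ; (rise _) → refl ; (fall _) → refl ; (level′ _) → refl })
      where
      to : ∀ {L h k} → Motzkin (suc L) (suc h) k →
           (Motzkin L h k ⊎ Motzkin L (suc h) k) ⊎ (Motzkin L (suc h) k ⊎ Motzkin L (suc (suc h)) k)
      to (fall p)   = inj₁ (inj₁ p)
      to (level p)  = inj₁ (inj₂ p)
      to (level′ p) = inj₂ (inj₁ p)
      to (rise p)   = inj₂ (inj₂ p)
      from : ∀ {L h k} → (Motzkin L h k ⊎ Motzkin L (suc h) k) ⊎ (Motzkin L (suc h) k ⊎ Motzkin L (suc (suc h)) k) →
             Motzkin (suc L) (suc h) k
      from (inj₁ (inj₁ p)) = fall p
      from (inj₁ (inj₂ p)) = level p
      from (inj₂ (inj₁ p)) = level′ p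
      from (inj₂ (inj₂ p)) = rise p

    _⊎-Fin_ : ∀ {A B : Set} {a b} → A ↔ Fin a → B ↔ Fin b → (A ⊎ B) ↔ Fin (a + b)
    A↔a ⊎-Fin B↔b = ↔-trans (A↔a ⊎-↔ B↔b) (↔-sym +↔⊎)

    empty↔Fin0 : ∀ {A : Set} → (A → ⊥) → A ↔ Fin 0
    empty↔Fin0 ¬a = ↔-trans (mk↔ₛ′ ¬a (λ ()) (λ ()) (λ a → contradiction a ¬a)) (↔-sym 0↔⊥)

  Motzkin↔Fin : ∀ L h k → Motzkin L h k ↔ Fin (motzkinCount L h k)
  Motzkin↔Fin zero    zero    zero    =
    mk↔ₛ′ (λ _ → Fin.zero) (λ _ → end) (λ { Fin.zero → refl ; (Fin.suc ()) }) (λ { end → refl })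
  Motzkin↔Fin zero    zero    (suc k) = empty↔Fin0 λ ()
  Motzkin↔Fin zero    (suc h) k       = empty↔Fin0 λ ()
  Motzkin↔Fin (suc L) zero    zero    = ↔-trans firstStep-0-0 (Motzkin↔Fin L 0 0 ⊎-Fin Motzkin↔Fin L 1 0)
  Motzkin↔Fin (suc L) zero    (suc k) =
    ↔-trans firstStep-0-suc (Motzkin↔Fin L 0 k ⊎-Fin (Motzkin↔Fin L 0 (suc k) ⊎-Fin Motzkin↔Fin L 1 (suc k)))
  Motzkin↔Fin (suc L) (suc h) k       = ↔-trans firstStep-suc
    ((Motzkin↔Fin L h k ⊎-Fin Motzkin↔Fin L (suc h) k) ⊎-Fin (Motzkin↔Fin L (suc h) k ⊎-Fin Motzkin↔Fin L (suc (suc h)) k))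

  motzkinCount≡ballot : ∀ L h k → motzkinCount L h k ≡ ballot (double L ∸ k) (double h + k)
  motzkinCount≡ballot zero    zero    zero    = refl
  motzkinCount≡ballot zero    zero    (suc k) = refl
  motzkinCount≡ballot zero    (suc h) zero    = refl
  motzkinCount≡ballot zero    (suc h) (suc k) = refl
  motzkinCount≡ballot (suc L) zero    zero
    rewrite motzkinCount≡ballot L 0 0 | motzkinCount≡ballot L 1 0 = refl
  motzkinCount≡ballot (suc L) zero    (suc k)
    rewrite motzkinCount≡ballot L 0 k | motzkinCount≡ballot L 0 (suc k) | motzkinCount≡ballot L 1 (suc k) =
    sym (trans (ballot-step (double L) k k ≤-refl) (cong (ballot (double L ∸ k) k +_) (step L k)))
    where
    step : ∀ L k → ballot (double L ∸ k) (suc (suc k)) ≡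
                   ballot (double L ∸ suc k) (suc k) + ballot (double L ∸ suc k) (suc (suc (suc k)))
    step zero    zero    = refl
    step zero    (suc _) = refl
    step (suc L) k       = ballot-step (suc (double L)) k (suc k) (n≤1+n k)
  motzkinCount≡ballot (suc L) (suc h) k
    rewrite motzkinCount≡ballot L h k | motzkinCount≡ballot L (suc h) k | motzkinCount≡ballot L (suc (suc h)) k =
    sym (trans (ballot-step (suc (double L)) k (suc H) (≤-trans k≤H (n≤1+n H)))
               (cong₂ _+_ (ballot-step (double L) k H k≤H)
                          (ballot-step (double L) k (suc (suc H)) (≤-trans k≤H (≤-trans (n≤1+n H) (n≤1+n (suc H)))))))
    where
    H = double h + k
    k≤H : k ≤ H
    k≤H = m≤n+m k (double h)

module LevelSets where

  open import Data.Nat using (ℕ; zero; suc)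
  open import Data.Nat.Properties using (suc-injective; 0≢1+n; ≡-irrelevant)
  open import Data.Empty using (⊥; ⊥-elim)
  open import Data.Product using (Σ; _,_; proj₁; proj₂)
  open import Function using (_∘_)
  open import Function.Bundles using (_↔_; mk↔ₛ′)
  open import Relation.Binary.PropositionalEquality

  Shifted : (ℕ → Set) → ℕ → Set
  Shifted F zero    = ⊥
  Shifted F (suc k) = F k

  module _ {X : Set} {F : ℕ → Set} (stat : X → ℕ) (to : Σ ℕ F → X) (from : X → Σ ℕ F)
           (from-to : ∀ a → from (to a) ≡ a) (to-from : ∀ x → to (from x) ≡ x)
           (stat-to : ∀ k a → stat (to (k , a)) ≡ suc k) where

    private
      stat-from : ∀ x → stat x ≡ suc (proj₁ (from x))
      stat-from x = trans (cong stat (sym (to-from x))) (stat-to (proj₁ (from x)) (proj₂ (from x)))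

      index : ∀ {x K} → stat x ≡ suc K → proj₁ (from x) ≡ K
      index {x} p = suc-injective (trans (sym (stat-from x)) p)

    levelSet↔ : ∀ K → (Σ X λ x → stat x ≡ K) ↔ Shifted F K
    levelSet↔ zero = mk↔ₛ′ empty (λ ()) (λ ()) (⊥-elim ∘ empty)
      where
      empty : (Σ X λ x → stat x ≡ 0) → ⊥
      empty (x , p) = 0≢1+n (trans (sym p) (stat-from x))
    levelSet↔ (suc K) = mk↔ₛ′ forth back forth-back back-forth
      where
      forth : (Σ X λ x → stat x ≡ suc K) → F K
      forth (x , p) = subst F (index p) (proj₂ (from x))
      back : F K → Σ X λ x → stat x ≡ suc K
      back a = to (K , a) , stat-to K a
      forth-back : ∀ a → forth (back a) ≡ a
      forth-back a = transport (from (to (K , a))) (from-to (K , a)) (index (stat-to K a))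
        where
        transport : ∀ (b : Σ ℕ F) → b ≡ (K , a) → (q : proj₁ b ≡ K) → subst F q (proj₂ b) ≡ a
        transport .(K , a) refl q rewrite ≡-irrelevant q refl = refl
      back-forth : ∀ xp → back (forth xp) ≡ xp
      back-forth (x , p) = transport (from x) (to-from x) (index p) p
        where
        transport : ∀ (b : Σ ℕ F) → to b ≡ x → (q : proj₁ b ≡ K) → (p : stat x ≡ suc K) →
                    back (subst F q (proj₂ b)) ≡ (x , p)
        transport (k , c) refl refl p = cong (to (k , c) ,_) (≡-irrelevant _ _)


module DyckPaths where

  open import Defs
  open BallotNumbers using (double; double≡+)
  open MotzkinPaths
  open LevelSets
  open import Data.Nat as ℕ using (ℕ; zero; suc; _+_; _≤_; _≰_; _<_; z≤n; s≤s; z<s)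
  open import Data.Nat.Properties
  open import Data.Nat.Tactic.RingSolver using (solve-∀)
  open import Data.List using (List; []; _∷_; length; filter)
  open import Data.List.Properties using (filter-accept; filter-reject)
  open import Data.List.Relation.Unary.All using (All; []; _∷_)
  import Data.List.Relation.Unary.All as All
  open import Data.Product using (Σ; _×_; _,_; proj₁; proj₂)
  open import Data.Product.Properties using (,-injectiveˡ; ,-injectiveʳ)
  open import Data.Empty.Irrelevant using (⊥-elim)
  open import Function using (_∘_)
  open import Function.Bundles using (_↔_)
  open import Relation.Nullary using (¬_)
  open import Relation.Binary.PropositionalEquality

  -- A Dyck path of semilength L + 1 is E followed by 2L + 1 steps; cut these into pairs (and a final N),
  -- reading EN, EE, NN, NE as level, rise, fall, level′ of a Motzkin path whose height h is the
  -- distance x - y = 2h + 1 from the diagonal.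
  steps : ∀ {L h k} → Motzkin L h k → List Step
  steps end         = N ∷ []
  steps (level p)   = E ∷ N ∷ steps p
  steps (rise p)    = E ∷ E ∷ steps p
  steps (fall p)    = N ∷ N ∷ steps p
  steps (level′ p)  = N ∷ E ∷ steps p
  steps (level′₀ p) = N ∷ E ∷ steps p

  endFrom : ℕ → ℕ → List Step → ℕ × ℕ
  endFrom x y []      = (x , y)
  endFrom x y (E ∷ s) = endFrom (suc x) y s
  endFrom x y (N ∷ s) = endFrom x (suc y) s

  endFrom-endpoint : ∀ x y s → endFrom x y s ≡ (x + proj₁ (endpoint s) , y + proj₂ (endpoint s))
  endFrom-endpoint x y []      = cong₂ _,_ (sym (+-identityʳ x)) (sym (+-identityʳ y))
  endFrom-endpoint x y (E ∷ s) =
    trans (endFrom-endpoint (suc x) y s) (cong (_, y + proj₂ (endpoint s)) (sym (+-suc x _)))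
  endFrom-endpoint x y (N ∷ s) =
    trans (endFrom-endpoint x (suc y) s) (cong (x + proj₁ (endpoint s) ,_) (sym (+-suc y _)))

  length-endpoint : ∀ s → length s ≡ proj₁ (endpoint s) + proj₂ (endpoint s)
  length-endpoint []      = refl
  length-endpoint (E ∷ s) = cong suc (length-endpoint s)
  length-endpoint (N ∷ s) = trans (cong suc (length-endpoint s)) (sym (+-suc _ _))

  Below : List (ℕ × ℕ) → Set
  Below = All (λ p → proj₂ p ≤ proj₁ p)

  diagonalPoints : List (ℕ × ℕ) → ℕ
  diagonalPoints ps = length (filter (λ p → proj₁ p ℕ.≟ proj₂ p) ps)

  diagonalPoints-off : ∀ {a b} ps → a ≢ b → diagonalPoints ((a , b) ∷ ps) ≡ diagonalPoints ps
  diagonalPoints-off ps a≢b = cong length (filter-reject (λ p → proj₁ p ℕ.≟ proj₂ p) {xs = ps} a≢b)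

  diagonalPoints-on : ∀ {a b} ps → a ≡ b → diagonalPoints ((a , b) ∷ ps) ≡ suc (diagonalPoints ps)
  diagonalPoints-on ps a≡b = cong length (filter-accept (λ p → proj₁ p ℕ.≟ proj₂ p) {xs = ps} a≡b)

  private
    module Offset {x y h : ℕ} (x≡ : x ≡ y + suc (double h)) where
      y<x : y < x
      y<x = subst (y <_) (sym x≡) (m<m+n y z<s)
      y≤x : y ≤ x
      y≤x = <⇒≤ y<x

    offset-rise : ∀ {x y h} → x ≡ y + suc (double h) → suc (suc x) ≡ y + suc (double (suc h))
    offset-rise {y = y} x≡ = trans (cong (suc ∘ suc) x≡) (sym (trans (+-suc y _) (cong suc (+-suc y _))))

    offset-fall : ∀ {x y h} → x ≡ y + suc (double (suc h)) → x ≡ suc (suc y) + suc (double h)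
    offset-fall {y = y} x≡ = trans x≡ (trans (+-suc y _) (cong suc (+-suc y _)))

    last-E-off-diagonal : ∀ {x y h} → x ≡ y + suc (double h) → suc x ≢ y
    last-E-off-diagonal {x} x≡ refl = <-irrefl refl (<-trans (Offset.y<x x≡) (n<1+n x))

    last-N-off-diagonal : ∀ {x y h} → x ≡ y + suc (double (suc h)) → x ≢ suc y
    last-N-off-diagonal {y = y} {h} x≡ refl = <-irrefl refl (<-trans (n<1+n (suc y)) (Offset.y<x {h = h} (offset-fall x≡)))

    NN-above-diagonal : ∀ {x y} → x ≡ y + 1 → suc (suc y) ≰ x
    NN-above-diagonal {y = y} x≡ 2+y≤x = <-irrefl refl (≤-trans 2+y≤x (≤-reflexive (trans x≡ (+-comm y 1))))

  steps-below : ∀ {L h k} (p : Motzkin L h k) x y → x ≡ y + suc (double h) → Below (pointsFrom x y (steps p))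
  steps-below end x y x≡ = Offset.y<x x≡ ∷ []
  steps-below (level p) x y x≡ =
    m≤n⇒m≤1+n (Offset.y≤x x≡) ∷ s≤s (Offset.y≤x x≡) ∷ steps-below p (suc x) (suc y) (cong suc x≡)
  steps-below (rise p) x y x≡ =
    m≤n⇒m≤1+n (Offset.y≤x x≡) ∷ m≤n⇒m≤1+n (m≤n⇒m≤1+n (Offset.y≤x x≡)) ∷
    steps-below p (suc (suc x)) y (offset-rise x≡)
  steps-below {h = suc h} (fall p) x y x≡ =
    <⇒≤ (<-trans (n<1+n (suc y)) y+2<x) ∷ <⇒≤ y+2<x ∷ steps-below p x (suc (suc y)) (offset-fall x≡)
    where y+2<x = Offset.y<x {h = h} (offset-fall x≡)
  steps-below {h = suc h} (level′ p) x y x≡ =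
    <⇒≤ (<-trans (n<1+n (suc y)) y+2<x) ∷ s≤s (Offset.y≤x x≡) ∷ steps-below p (suc x) (suc y) (cong suc x≡)
    where y+2<x = Offset.y<x {h = h} (offset-fall x≡)
  steps-below (level′₀ p) x y x≡ =
    ≤-reflexive (trans (+-comm 1 y) (sym x≡)) ∷ s≤s (Offset.y≤x x≡) ∷ steps-below p (suc x) (suc y) (cong suc x≡)

  steps-end : ∀ {L h k} (p : Motzkin L h k) x y → x ≡ y + suc (double h) →
              endFrom x y (steps p) ≡ (y + suc (L + h) , y + suc (L + h))
  steps-end end x y x≡ = cong₂ _,_ x≡ (+-comm 1 y)
  steps-end {suc L} {h} (level p) x y x≡ =
    trans (steps-end p (suc x) (suc y) (cong suc x≡)) (cong (λ z → z , z) (shift y L h))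
    where
    shift : ∀ y L h → suc y + suc (L + h) ≡ y + suc (suc L + h)
    shift = solve-∀
  steps-end {suc L} {h} (rise p) x y x≡ =
    trans (steps-end p (suc (suc x)) y (offset-rise x≡)) (cong (λ z → z , z) (shift y L h))
    where
    shift : ∀ y L h → y + suc (L + suc h) ≡ y + suc (suc L + h)
    shift = solve-∀
  steps-end {suc L} {suc h} (fall p) x y x≡ =
    trans (steps-end p x (suc (suc y)) (offset-fall x≡)) (cong (λ z → z , z) (shift y L h))
    where
    shift : ∀ y L h → suc (suc y) + suc (L + h) ≡ y + suc (suc L + suc h)
    shift = solve-∀
  steps-end {suc L} {h} (level′ p) x y x≡ =
    trans (steps-end p (suc x) (suc y) (cong suc x≡)) (cong (λ z → z , z) (shift y L h))
    where
    shift : ∀ y L h → suc y + suc (L + h) ≡ y + suc (suc L + h)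
    shift = solve-∀
  steps-end {suc L} (level′₀ p) x y x≡ =
    trans (steps-end p (suc x) (suc y) (cong suc x≡)) (cong (λ z → z , z) (shift y L))
    where
    shift : ∀ y L → suc y + suc (L + 0) ≡ y + suc (suc L + 0)
    shift = solve-∀

  steps-diagonalPoints : ∀ {L h k} (p : Motzkin L h k) x y → x ≡ y + suc (double h) →
                         diagonalPoints (pointsFrom x y (steps p)) ≡ suc k
  steps-diagonalPoints end x y x≡ = diagonalPoints-on [] (trans x≡ (+-comm y 1))
  steps-diagonalPoints (level p) x y x≡ =
    trans (diagonalPoints-off _ (>⇒≢ (m≤n⇒m≤1+n (Offset.y<x x≡))))
   (trans (diagonalPoints-off _ (>⇒≢ (s≤s (Offset.y<x x≡))))
          (steps-diagonalPoints p (suc x) (suc y) (cong suc x≡)))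
  steps-diagonalPoints (rise p) x y x≡ =
    trans (diagonalPoints-off _ (>⇒≢ (m≤n⇒m≤1+n (Offset.y<x x≡))))
   (trans (diagonalPoints-off _ (>⇒≢ (m≤n⇒m≤1+n (m≤n⇒m≤1+n (Offset.y<x x≡)))))
          (steps-diagonalPoints p (suc (suc x)) y (offset-rise x≡)))
  steps-diagonalPoints {h = suc h} (fall p) x y x≡ =
    trans (diagonalPoints-off _ (>⇒≢ (<-trans (n<1+n (suc y)) y+2<x)))
   (trans (diagonalPoints-off _ (>⇒≢ y+2<x))
          (steps-diagonalPoints p x (suc (suc y)) (offset-fall x≡)))
    where y+2<x = Offset.y<x {h = h} (offset-fall x≡)
  steps-diagonalPoints {h = suc h} (level′ p) x y x≡ =
    trans (diagonalPoints-off _ (>⇒≢ (<-trans (n<1+n (suc y)) (Offset.y<x {h = h} (offset-fall x≡)))))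
   (trans (diagonalPoints-off _ (>⇒≢ (s≤s (Offset.y<x x≡))))
          (steps-diagonalPoints p (suc x) (suc y) (cong suc x≡)))
  steps-diagonalPoints (level′₀ p) x y x≡ =
    trans (diagonalPoints-on _ (trans x≡ (+-comm y 1)))
          (cong suc (trans (diagonalPoints-off _ (>⇒≢ (s≤s (Offset.y<x x≡))))
                           (steps-diagonalPoints p (suc x) (suc y) (cong suc x≡))))

  private
    Below-drop₂ : ∀ {p q ps} → Below (p ∷ q ∷ ps) → Below ps
    Below-drop₂ (_ ∷ _ ∷ below) = below

    Below-second : ∀ {p q ps} → Below (p ∷ q ∷ ps) → proj₂ q ≤ proj₁ q
    Below-second (_ ∷ q≤ ∷ _) = q≤

  decodeSteps : ∀ h L x y → .(x ≡ y + suc (double h)) → (s : List Step) → .(length s ≡ suc (double L)) →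
                .(Below (pointsFrom x y s)) → .(proj₁ (endFrom x y s) ≡ proj₂ (endFrom x y s)) → Σ ℕ (Motzkin L h)
  decodeSteps h       zero    x y x≡ []            len b e = ⊥-elim (0≢1+n len)
  decodeSteps zero    zero    x y x≡ (N ∷ [])      len b e = 0 , end
  decodeSteps (suc h) zero    x y x≡ (N ∷ [])      len b e = ⊥-elim (last-N-off-diagonal x≡ e)
  decodeSteps h       zero    x y x≡ (E ∷ [])      len b e = ⊥-elim (last-E-off-diagonal x≡ e)
  decodeSteps h       zero    x y x≡ (_ ∷ _ ∷ s)   len b e = ⊥-elim (1+n≢0 (suc-injective len))
  decodeSteps h       (suc L) x y x≡ []            len b e = ⊥-elim (0≢1+n len)
  decodeSteps h       (suc L) x y x≡ (_ ∷ [])      len b e = ⊥-elim (0≢1+n (suc-injective len))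
  decodeSteps h       (suc L) x y x≡ (E ∷ E ∷ s)   len b e =
    cons-rise (decodeSteps (suc h) L (suc (suc x)) y (offset-rise x≡) s (suc-injective (suc-injective len)) (Below-drop₂ b) e)
  decodeSteps h       (suc L) x y x≡ (E ∷ N ∷ s)   len b e =
    cons-level (decodeSteps h L (suc x) (suc y) (cong suc x≡) s (suc-injective (suc-injective len)) (Below-drop₂ b) e)
  decodeSteps zero    (suc L) x y x≡ (N ∷ N ∷ s)   len b e = ⊥-elim (NN-above-diagonal x≡ (Below-second b))
  decodeSteps (suc h) (suc L) x y x≡ (N ∷ N ∷ s)   len b e =
    cons-fall (decodeSteps h L x (suc (suc y)) (offset-fall x≡) s (suc-injective (suc-injective len)) (Below-drop₂ b) e)
  decodeSteps zero    (suc L) x y x≡ (N ∷ E ∷ s)   len b e =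
    cons-level′₀ (decodeSteps zero L (suc x) (suc y) (cong suc x≡) s (suc-injective (suc-injective len)) (Below-drop₂ b) e)
  decodeSteps (suc h) (suc L) x y x≡ (N ∷ E ∷ s)   len b e =
    cons-level′ (decodeSteps (suc h) L (suc x) (suc y) (cong suc x≡) s (suc-injective (suc-injective len)) (Below-drop₂ b) e)

  decodeSteps-steps : ∀ {L h k} (p : Motzkin L h k) x y .(x≡ : x ≡ y + suc (double h))
    .(len : length (steps p) ≡ suc (double L)) .(b : Below (pointsFrom x y (steps p)))
    .(e : proj₁ (endFrom x y (steps p)) ≡ proj₂ (endFrom x y (steps p))) →
    decodeSteps h L x y x≡ (steps p) len b e ≡ (k , p)
  decodeSteps-steps end         x y x≡ len b e = refl
  decodeSteps-steps (level p)   x y x≡ len b e = cong cons-level (decodeSteps-steps p (suc x) (suc y) _ _ _ _)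
  decodeSteps-steps (rise p)    x y x≡ len b e = cong cons-rise (decodeSteps-steps p (suc (suc x)) y _ _ _ _)
  decodeSteps-steps (fall p)    x y x≡ len b e = cong cons-fall (decodeSteps-steps p x (suc (suc y)) _ _ _ _)
  decodeSteps-steps (level′ p)  x y x≡ len b e = cong cons-level′ (decodeSteps-steps p (suc x) (suc y) _ _ _ _)
  decodeSteps-steps (level′₀ p) x y x≡ len b e = cong cons-level′₀ (decodeSteps-steps p (suc x) (suc y) _ _ _ _)

  steps-decodeSteps : ∀ h L x y .(x≡ : x ≡ y + suc (double h)) (s : List Step) .(len : length s ≡ suc (double L))
    .(b : Below (pointsFrom x y s)) .(e : proj₁ (endFrom x y s) ≡ proj₂ (endFrom x y s)) →
    steps (proj₂ (decodeSteps h L x y x≡ s len b e)) ≡ s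
  steps-decodeSteps h       zero    x y x≡ []          len b e = ⊥-elim (0≢1+n len)
  steps-decodeSteps zero    zero    x y x≡ (N ∷ [])    len b e = refl
  steps-decodeSteps (suc h) zero    x y x≡ (N ∷ [])    len b e = ⊥-elim (last-N-off-diagonal x≡ e)
  steps-decodeSteps h       zero    x y x≡ (E ∷ [])    len b e = ⊥-elim (last-E-off-diagonal x≡ e)
  steps-decodeSteps h       zero    x y x≡ (_ ∷ _ ∷ s) len b e = ⊥-elim (1+n≢0 (suc-injective len))
  steps-decodeSteps h       (suc L) x y x≡ []          len b e = ⊥-elim (0≢1+n len)
  steps-decodeSteps h       (suc L) x y x≡ (_ ∷ [])    len b e = ⊥-elim (0≢1+n (suc-injective len))
  steps-decodeSteps h       (suc L) x y x≡ (E ∷ E ∷ s) len b e =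
    cong (λ s → E ∷ E ∷ s) (steps-decodeSteps (suc h) L (suc (suc x)) y _ s _ _ _)
  steps-decodeSteps h       (suc L) x y x≡ (E ∷ N ∷ s) len b e =
    cong (λ s → E ∷ N ∷ s) (steps-decodeSteps h L (suc x) (suc y) _ s _ _ _)
  steps-decodeSteps zero    (suc L) x y x≡ (N ∷ N ∷ s) len b e = ⊥-elim (NN-above-diagonal x≡ (Below-second b))
  steps-decodeSteps (suc h) (suc L) x y x≡ (N ∷ N ∷ s) len b e =
    cong (λ s → N ∷ N ∷ s) (steps-decodeSteps h L x (suc (suc y)) _ s _ _ _)
  steps-decodeSteps zero    (suc L) x y x≡ (N ∷ E ∷ s) len b e =
    cong (λ s → N ∷ E ∷ s) (steps-decodeSteps zero L (suc x) (suc y) _ s _ _ _)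
  steps-decodeSteps (suc h) (suc L) x y x≡ (N ∷ E ∷ s) len b e =
    cong (λ s → N ∷ E ∷ s) (steps-decodeSteps (suc h) L (suc x) (suc y) _ s _ _ _)

  toDyck : ∀ {L} → Σ ℕ (Motzkin L 0) → Dyck (suc L)
  toDyck {L} (k , p) = record { path = E ∷ steps p ; below = z≤n ∷ steps-below p 1 0 refl ; ends = endsOnDiagonal }
    where
    endsOnDiagonal : endpoint (E ∷ steps p) ≡ (suc L , suc L)
    endsOnDiagonal = trans (trans (sym (endFrom-endpoint 1 0 (steps p))) (steps-end p 1 0 refl))
                 (cong (λ z → suc z , suc z) (+-identityʳ L))

  private
    ¬N-first : ∀ {s} → ¬ Below (points (N ∷ s))
    ¬N-first (() ∷ _)

    length-tail : ∀ {L} s → endpoint (E ∷ s) ≡ (suc L , suc L) → length s ≡ suc (double L)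
    length-tail {L} s arrives = begin
      length s                                  ≡⟨ length-endpoint s ⟩
      proj₁ (endpoint s) + proj₂ (endpoint s)   ≡⟨ cong₂ _+_ (suc-injective (,-injectiveˡ arrives)) (,-injectiveʳ arrives) ⟩
      L + suc L                                 ≡⟨ +-suc L L ⟩
      suc (L + L)                               ≡⟨ cong suc (sym (double≡+ L)) ⟩
      suc (double L)                            ∎
      where open ≡-Reasoning

    diagonal-end : ∀ {L} s → endpoint (E ∷ s) ≡ (suc L , suc L) → proj₁ (endFrom 1 0 s) ≡ proj₂ (endFrom 1 0 s)
    diagonal-end s arrives = trans (cong proj₁ (endFrom-endpoint 1 0 s))
      (trans (,-injectiveˡ arrives) (trans (sym (,-injectiveʳ arrives)) (sym (cong proj₂ (endFrom-endpoint 1 0 s)))))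

  fromPath : ∀ L (s : List Step) → .(Below (points s)) → .(endpoint s ≡ (suc L , suc L)) → Σ ℕ (Motzkin L 0)
  fromPath L []      b arrives = ⊥-elim (0≢1+n (,-injectiveˡ arrives))
  fromPath L (N ∷ s) b arrives = ⊥-elim (¬N-first b)
  fromPath L (E ∷ s) b arrives = decodeSteps 0 L 1 0 refl s (length-tail s arrives) (All.tail b) (diagonal-end s arrives)

  fromDyck : ∀ {L} → Dyck (suc L) → Σ ℕ (Motzkin L 0)
  fromDyck {L} record { path = s ; below = b ; ends = e } = fromPath L s b e

  fromDyck-toDyck : ∀ {L} (a : Σ ℕ (Motzkin L 0)) → fromDyck (toDyck a) ≡ a
  fromDyck-toDyck (k , p) = decodeSteps-steps p 1 0 _ _ _ _

  toDyck-fromPath : ∀ L (s : List Step) .(b : Below (points s)) .(arrives : endpoint s ≡ (suc L , suc L)) →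
                    E ∷ steps (proj₂ (fromPath L s b arrives)) ≡ s
  toDyck-fromPath L []      b arrives = ⊥-elim (0≢1+n (,-injectiveˡ arrives))
  toDyck-fromPath L (N ∷ s) b arrives = ⊥-elim (¬N-first b)
  toDyck-fromPath L (E ∷ s) b arrives = cong (E ∷_) (steps-decodeSteps 0 L 1 0 refl s _ _ _)

  toDyck-fromDyck : ∀ {L} (D : Dyck (suc L)) → toDyck (fromDyck D) ≡ D
  toDyck-fromDyck {L} record { path = s ; below = b ; ends = e } = Dyck-≡ (toDyck-fromPath L s b e)
    where
    Dyck-≡ : ∀ {D₁ D₂ : Dyck (suc L)} → path D₁ ≡ path D₂ → D₁ ≡ D₂
    Dyck-≡ {record { path = s }} {record { path = .s }} refl = refl

  touch-toDyck : ∀ {L} k (p : Motzkin L 0 k) → touch (toDyck (k , p)) ≡ suc k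
  touch-toDyck k p = trans (diagonalPoints-off {1} {0} (pointsFrom 1 0 (steps p)) λ ()) (steps-diagonalPoints p 1 0 refl)

  dyck↔Motzkin : ∀ L K → (Σ (Dyck (suc L)) λ D → touch D ≡ K) ↔ Shifted (Motzkin L 0) K
  dyck↔Motzkin L = levelSet↔ touch toDyck fromDyck fromDyck-toDyck toDyck-fromDyck touch-toDyck

module Walks where

  open MotzkinPaths
  open import Data.Nat as ℕ using (ℕ; zero; suc; _+_; _≤_; _≰_; s≤s; z<s)
  open import Data.Nat.Properties
  open import Data.Fin using (Fin; toℕ)
  import Data.Fin as Fin
  open import Data.Vec using (Vec; []; _∷_; lookup)
  open import Data.Product using (Σ; ∃; _×_; _,_; proj₁; proj₂)
  open import Data.Empty.Irrelevant using (⊥-elim)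
  open import Function using (_∘_)
  open import Relation.Nullary using (yes; no)
  open import Relation.Nullary.Decidable using (recompute)
  open import Relation.Binary.PropositionalEquality

  -- The cells (row , col) holding the elements 2, 3, … of a nondecreasing partition matrix whose element 1
  -- lies in cell (r , c): a level step stays in the cell, rise moves one column right, fall one row down,
  -- level′ diagonally; the height is the distance c - r from the diagonal.
  positions : ∀ {L h k} → Motzkin L h k → ℕ → ℕ → Vec (ℕ × ℕ) L
  positions end         r c = []
  positions (level p)   r c = (r , c) ∷ positions p r c
  positions (rise p)    r c = (r , suc c) ∷ positions p r (suc c)
  positions (fall p)    r c = (suc r , c) ∷ positions p (suc r) c
  positions (level′ p)  r c = (suc r , suc c) ∷ positions p (suc r) (suc c)
  positions (level′₀ p) r c = (suc r , suc c) ∷ positions p (suc r) (suc c)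

  record Move (r c r′ c′ : ℕ) : Set where
    constructor move
    field
      row≤    : r ≤ r′
      row≤suc : r′ ≤ suc r
      col≤    : c ≤ c′
      col≤suc : c′ ≤ suc c
      upper   : r′ ≤ c′

  Walk : ∀ {L} → ℕ → ℕ → Vec (ℕ × ℕ) L → Set
  Walk r c []               = r ≡ c
  Walk r c ((r′ , c′) ∷ ps) = Move r c r′ c′ × Walk r′ c′ ps

  finalPosition : ∀ {L} → ℕ → ℕ → Vec (ℕ × ℕ) L → ℕ × ℕ
  finalPosition r c []               = r , c
  finalPosition r c ((r′ , c′) ∷ ps) = finalPosition r′ c′ ps

  rowAt colAt : ∀ {n} → Vec (ℕ × ℕ) n → Fin n → ℕ
  rowAt ps i = proj₁ (lookup ps i)
  colAt ps i = proj₂ (lookup ps i)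

  height-rise : ∀ {r c h} → c ≡ r + h → suc c ≡ r + suc h
  height-rise {r} c≡ = trans (cong suc c≡) (sym (+-suc r _))

  height-fall : ∀ {r c h} → c ≡ r + suc h → c ≡ suc r + h
  height-fall {r} c≡ = trans c≡ (+-suc r _)

  private
    Walk-subst : ∀ {L r c r′ c′} {ps : Vec (ℕ × ℕ) L} → r ≡ r′ → c ≡ c′ → Walk r c ps → Walk r′ c′ ps
    Walk-subst refl refl w = w

    row-moved : ∀ {r c r′ c′} → r′ ≢ r → .(Move r c r′ c′) → r′ ≡ suc r
    row-moved {r} {r′ = r′} r′≢r m =
      recompute (r′ ℕ.≟ suc r) (≤-antisym (Move.row≤suc m) (≤∧≢⇒< (Move.row≤ m) (r′≢r ∘ sym)))

    col-moved : ∀ {r c r′ c′} → c′ ≢ c → .(Move r c r′ c′) → c′ ≡ suc c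
    col-moved {c = c} {c′ = c′} c′≢c m =
      recompute (c′ ℕ.≟ suc c) (≤-antisym (Move.col≤suc m) (≤∧≢⇒< (Move.col≤ m) (c′≢c ∘ sym)))

    ground-fall-below : ∀ {r c c′} → c ≡ r + 0 → c′ ≡ c → suc r ≰ c′
    ground-fall-below {r} c≡ refl r<c = <-irrefl refl (≤-trans r<c (≤-reflexive (trans c≡ (+-identityʳ r))))

    ends-off-diagonal : ∀ {r c h} → c ≡ r + suc h → r ≢ c
    ends-off-diagonal {r} c≡ refl = <-irrefl refl (≤-trans (m<m+n r z<s) (≤-reflexive (sym c≡)))

  decodeWalk : ∀ L h r c → .(c ≡ r + h) → (ps : Vec (ℕ × ℕ) L) → .(Walk r c ps) → Σ ℕ (Motzkin L h)
  decodeWalk zero    zero    r c c≡ []               w = 0 , end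
  decodeWalk zero    (suc h) r c c≡ []               w = ⊥-elim (ends-off-diagonal c≡ w)
  decodeWalk (suc L) h       r c c≡ ((r′ , c′) ∷ ps) w with r′ ℕ.≟ r | c′ ℕ.≟ c
  ... | yes r′≡r | yes c′≡c = cons-level (decodeWalk L h r c c≡ ps (Walk-subst r′≡r c′≡c (proj₂ w)))
  ... | yes r′≡r | no  c′≢c =
    cons-rise (decodeWalk L (suc h) r (suc c) (height-rise c≡) ps (Walk-subst r′≡r (col-moved c′≢c (proj₁ w)) (proj₂ w)))
  decodeWalk (suc L) zero    r c c≡ ((r′ , c′) ∷ ps) w | no r′≢r | yes c′≡c =
    ⊥-elim (ground-fall-below c≡ c′≡c (subst (_≤ c′) (row-moved r′≢r (proj₁ w)) (Move.upper (proj₁ w))))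
  decodeWalk (suc L) (suc h) r c c≡ ((r′ , c′) ∷ ps) w | no r′≢r | yes c′≡c =
    cons-fall (decodeWalk L h (suc r) c (height-fall c≡) ps (Walk-subst (row-moved r′≢r (proj₁ w)) c′≡c (proj₂ w)))
  decodeWalk (suc L) zero    r c c≡ ((r′ , c′) ∷ ps) w | no r′≢r | no c′≢c =
    cons-level′₀ (decodeWalk L zero (suc r) (suc c) (cong suc c≡) ps
                             (Walk-subst (row-moved r′≢r (proj₁ w)) (col-moved c′≢c (proj₁ w)) (proj₂ w)))
  decodeWalk (suc L) (suc h) r c c≡ ((r′ , c′) ∷ ps) w | no r′≢r | no c′≢c =
    cons-level′ (decodeWalk L (suc h) (suc r) (suc c) (cong suc c≡) ps
                            (Walk-subst (row-moved r′≢r (proj₁ w)) (col-moved c′≢c (proj₁ w)) (proj₂ w)))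

  decodeWalk-positions : ∀ {L h k} (p : Motzkin L h k) r c .(c≡ : c ≡ r + h) .(w : Walk r c (positions p r c)) →
                         decodeWalk L h r c c≡ (positions p r c) w ≡ (k , p)
  decodeWalk-positions end r c c≡ w = refl
  decodeWalk-positions (level p) r c c≡ w with r ℕ.≟ r | c ℕ.≟ c
  ... | yes _   | yes _   = cong cons-level (decodeWalk-positions p r c _ _)
  ... | no r≢r  | _       = ⊥-elim (r≢r refl)
  ... | yes _   | no c≢c  = ⊥-elim (c≢c refl)
  decodeWalk-positions (rise p) r c c≡ w with r ℕ.≟ r | suc c ℕ.≟ c
  ... | yes _   | no _    = cong cons-rise (decodeWalk-positions p r (suc c) _ _)
  ... | no r≢r  | _       = ⊥-elim (r≢r refl)
  ... | yes _   | yes c+1≡c = ⊥-elim (1+n≢n c+1≡c)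
  decodeWalk-positions (fall p) r c c≡ w with suc r ℕ.≟ r | c ℕ.≟ c
  ... | no _    | yes _   = cong cons-fall (decodeWalk-positions p (suc r) c _ _)
  ... | yes r+1≡r | _     = ⊥-elim (1+n≢n r+1≡r)
  ... | no _    | no c≢c  = ⊥-elim (c≢c refl)
  decodeWalk-positions (level′ p) r c c≡ w with suc r ℕ.≟ r | suc c ℕ.≟ c
  ... | no _    | no _    = cong cons-level′ (decodeWalk-positions p (suc r) (suc c) _ _)
  ... | yes r+1≡r | _     = ⊥-elim (1+n≢n r+1≡r)
  ... | no _    | yes c+1≡c = ⊥-elim (1+n≢n c+1≡c)
  decodeWalk-positions (level′₀ p) r c c≡ w with suc r ℕ.≟ r | suc c ℕ.≟ c
  ... | no _    | no _    = cong cons-level′₀ (decodeWalk-positions p (suc r) (suc c) _ _)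
  ... | yes r+1≡r | _     = ⊥-elim (1+n≢n r+1≡r)
  ... | no _    | yes c+1≡c = ⊥-elim (1+n≢n c+1≡c)

  positions-decodeWalk : ∀ L h r c .(c≡ : c ≡ r + h) (ps : Vec (ℕ × ℕ) L) .(w : Walk r c ps) →
                         positions (proj₂ (decodeWalk L h r c c≡ ps w)) r c ≡ ps
  positions-decodeWalk zero    zero    r c c≡ []               w = refl
  positions-decodeWalk zero    (suc h) r c c≡ []               w = ⊥-elim (ends-off-diagonal c≡ w)
  positions-decodeWalk (suc L) h       r c c≡ ((r′ , c′) ∷ ps) w with r′ ℕ.≟ r | c′ ℕ.≟ c
  ... | yes refl | yes refl = cong ((r , c) ∷_) (positions-decodeWalk L h r c _ ps _)
  ... | yes refl | no c′≢c  =
    cong₂ _∷_ (cong (r ,_) (sym (col-moved c′≢c (proj₁ w)))) (positions-decodeWalk L (suc h) r (suc c) _ ps _)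
  positions-decodeWalk (suc L) zero    r c c≡ ((r′ , c′) ∷ ps) w | no r′≢r | yes c′≡c =
    ⊥-elim (ground-fall-below c≡ c′≡c (subst (_≤ c′) (row-moved r′≢r (proj₁ w)) (Move.upper (proj₁ w))))
  positions-decodeWalk (suc L) (suc h) r c c≡ ((r′ , c′) ∷ ps) w | no r′≢r | yes refl =
    cong₂ _∷_ (cong (_, c) (sym (row-moved r′≢r (proj₁ w)))) (positions-decodeWalk L h (suc r) c _ ps _)
  positions-decodeWalk (suc L) zero    r c c≡ ((r′ , c′) ∷ ps) w | no r′≢r | no c′≢c =
    cong₂ _∷_ (cong₂ _,_ (sym (row-moved r′≢r (proj₁ w))) (sym (col-moved c′≢c (proj₁ w))))
              (positions-decodeWalk L zero (suc r) (suc c) _ ps _)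
  positions-decodeWalk (suc L) (suc h) r c c≡ ((r′ , c′) ∷ ps) w | no r′≢r | no c′≢c =
    cong₂ _∷_ (cong₂ _,_ (sym (row-moved r′≢r (proj₁ w))) (sym (col-moved c′≢c (proj₁ w))))
              (positions-decodeWalk L (suc h) (suc r) (suc c) _ ps _)

  private
    Walk-from≤ : ∀ {L} r c (ps : Vec (ℕ × ℕ) L) → Walk r c ps → ∀ i →
                 r ≤ rowAt ((r , c) ∷ ps) i × c ≤ colAt ((r , c) ∷ ps) i
    Walk-from≤ r c ps               w        Fin.zero    = ≤-refl , ≤-refl
    Walk-from≤ r c ((r′ , c′) ∷ ps) (m , w) (Fin.suc i) =
      let r′≤ , c′≤ = Walk-from≤ r′ c′ ps w i in ≤-trans (Move.row≤ m) r′≤ , ≤-trans (Move.col≤ m) c′≤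

  Walk-monotone : ∀ {L} r c (ps : Vec (ℕ × ℕ) L) → Walk r c ps → ∀ i j → toℕ i ≤ toℕ j →
                  rowAt ((r , c) ∷ ps) i ≤ rowAt ((r , c) ∷ ps) j × colAt ((r , c) ∷ ps) i ≤ colAt ((r , c) ∷ ps) j
  Walk-monotone r c ps               w       Fin.zero    j           _         = Walk-from≤ r c ps w j
  Walk-monotone r c ((r′ , c′) ∷ ps) (_ , w) (Fin.suc i) (Fin.suc j) (s≤s i≤j) = Walk-monotone r′ c′ ps w i j i≤j

  Walk-upper : ∀ {L} r c (ps : Vec (ℕ × ℕ) L) → Walk r c ps → r ≤ c →
               ∀ i → rowAt ((r , c) ∷ ps) i ≤ colAt ((r , c) ∷ ps) i
  Walk-upper r c ps               w       r≤c Fin.zero    = r≤c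
  Walk-upper r c ((r′ , c′) ∷ ps) (m , w) r≤c (Fin.suc i) = Walk-upper r′ c′ ps w (Move.upper m) i

  Walk-diagonal : ∀ {L} r c (ps : Vec (ℕ × ℕ) L) → Walk r c ps → proj₁ (finalPosition r c ps) ≡ proj₂ (finalPosition r c ps)
  Walk-diagonal r c []               r≡c     = r≡c
  Walk-diagonal r c ((r′ , c′) ∷ ps) (_ , w) = Walk-diagonal r′ c′ ps w

  Walk-col≤final : ∀ {L} r c (ps : Vec (ℕ × ℕ) L) → Walk r c ps →
                   ∀ i → colAt ((r , c) ∷ ps) i ≤ proj₂ (finalPosition r c ps)
  Walk-col≤final r c []               w       Fin.zero    = ≤-refl
  Walk-col≤final r c ((r′ , c′) ∷ ps) (m , w) Fin.zero    = ≤-trans (Move.col≤ m) (Walk-col≤final r′ c′ ps w Fin.zero)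
  Walk-col≤final r c ((r′ , c′) ∷ ps) (_ , w) (Fin.suc i) = Walk-col≤final r′ c′ ps w i

  Walk-rows-onto : ∀ {L} r c (ps : Vec (ℕ × ℕ) L) → Walk r c ps → ∀ x → r ≤ x → x ≤ proj₁ (finalPosition r c ps) →
                   ∃ λ i → rowAt ((r , c) ∷ ps) i ≡ x
  Walk-rows-onto r c []               w       x r≤x x≤ = Fin.zero , ≤-antisym r≤x x≤
  Walk-rows-onto r c ((r′ , c′) ∷ ps) (m , w) x r≤x x≤ with r ℕ.≟ x
  ... | yes r≡x = Fin.zero , r≡x
  ... | no  r≢x = let i , eq = Walk-rows-onto r′ c′ ps w x (≤-trans (Move.row≤suc m) (≤∧≢⇒< r≤x r≢x)) x≤
                  in Fin.suc i , eq

  Walk-cols-onto : ∀ {L} r c (ps : Vec (ℕ × ℕ) L) → Walk r c ps → ∀ x → c ≤ x → x ≤ proj₂ (finalPosition r c ps) →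
                   ∃ λ i → colAt ((r , c) ∷ ps) i ≡ x
  Walk-cols-onto r c []               w       x c≤x x≤ = Fin.zero , ≤-antisym c≤x x≤
  Walk-cols-onto r c ((r′ , c′) ∷ ps) (m , w) x c≤x x≤ with c ℕ.≟ x
  ... | yes c≡x = Fin.zero , c≡x
  ... | no  c≢x = let i , eq = Walk-cols-onto r′ c′ ps w x (≤-trans (Move.col≤suc m) (≤∧≢⇒< c≤x c≢x)) x≤
                  in Fin.suc i , eq

  positions-walk : ∀ {L h k} (p : Motzkin L h k) r c → c ≡ r + h → Walk r c (positions p r c)
  positions-walk end r c c≡ = sym (trans c≡ (+-identityʳ r))
  positions-walk (level p) r c c≡ =
    move ≤-refl (n≤1+n r) ≤-refl (n≤1+n c) (≤-trans (m≤m+n r _) (≤-reflexive (sym c≡))) ,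
    positions-walk p r c c≡
  positions-walk (rise p) r c c≡ =
    move ≤-refl (n≤1+n r) (n≤1+n c) ≤-refl (m≤n⇒m≤1+n (≤-trans (m≤m+n r _) (≤-reflexive (sym c≡)))) ,
    positions-walk p r (suc c) (height-rise c≡)
  positions-walk (fall p) r c c≡ =
    move (n≤1+n r) ≤-refl ≤-refl (n≤1+n c) (≤-trans (m≤m+n (suc r) _) (≤-reflexive (sym (height-fall c≡)))) ,
    positions-walk p (suc r) c (height-fall c≡)
  positions-walk (level′ p) r c c≡ =
    move (n≤1+n r) ≤-refl (n≤1+n c) ≤-refl (s≤s (≤-trans (m≤m+n r _) (≤-reflexive (sym c≡)))) ,
    positions-walk p (suc r) (suc c) (cong suc c≡)
  positions-walk (level′₀ p) r c c≡ =
    move (n≤1+n r) ≤-refl (n≤1+n c) ≤-refl (s≤s (≤-trans (m≤m+n r _) (≤-reflexive (sym c≡)))) ,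
    positions-walk p (suc r) (suc c) (cong suc c≡)

  finalRow : ∀ {L h k} → Motzkin L h k → ℕ → ℕ
  finalRow end         r = r
  finalRow (level p)   r = finalRow p r
  finalRow (rise p)    r = finalRow p r
  finalRow (fall p)    r = finalRow p (suc r)
  finalRow (level′ p)  r = finalRow p (suc r)
  finalRow (level′₀ p) r = finalRow p (suc r)

  finalRow-≥ : ∀ {L h k} (p : Motzkin L h k) r → r ≤ finalRow p r
  finalRow-≥ end         r = ≤-refl
  finalRow-≥ (level p)   r = finalRow-≥ p r
  finalRow-≥ (rise p)    r = finalRow-≥ p r
  finalRow-≥ (fall p)    r = <⇒≤ (finalRow-≥ p (suc r))
  finalRow-≥ (level′ p)  r = <⇒≤ (finalRow-≥ p (suc r))
  finalRow-≥ (level′₀ p) r = <⇒≤ (finalRow-≥ p (suc r))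

  finalPosition-positions : ∀ {L h k} (p : Motzkin L h k) r c → proj₁ (finalPosition r c (positions p r c)) ≡ finalRow p r
  finalPosition-positions end         r c = refl
  finalPosition-positions (level p)   r c = finalPosition-positions p r c
  finalPosition-positions (rise p)    r c = finalPosition-positions p r (suc c)
  finalPosition-positions (fall p)    r c = finalPosition-positions p (suc r) c
  finalPosition-positions (level′ p)  r c = finalPosition-positions p (suc r) (suc c)
  finalPosition-positions (level′₀ p) r c = finalPosition-positions p (suc r) (suc c)

module Layouts where

  open import Defs
  open MotzkinPaths
  open Walks
  open import Data.Nat using (ℕ; zero; suc; _+_; _∸_; _≤_; _<_; _≤?_; z≤n; s≤s; _<ᵇ_; _≤ᵇ_)
  open import Data.Nat.Properties
  open import Data.Bool as Bool using (Bool; true; false; _∧_; _∨_; if_then_else_)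
  import Data.Bool.Properties as Bool
  open import Data.Fin using (Fin; toℕ; fromℕ<)
  import Data.Fin as Fin
  open import Data.Fin.Properties using (toℕ-fromℕ<; toℕ-injective; toℕ<n)
  open import Data.Vec using (Vec; []; _∷_; lookup; tabulate)
  open import Data.Vec.Properties using (lookup∘tabulate)
  open import Data.List using (List; []; _∷_; length; filter; map; applyUpTo; upTo)
  open import Data.Product using (∃; _×_; _,_; proj₁; proj₂)
  open import Data.Empty.Irrelevant using (⊥-elim)
  open import Function using (_∘_)
  open import Relation.Nullary using (yes; no)
  open import Relation.Binary.PropositionalEquality

  record Layout (M : ℕ) {n} (ps : Vec (ℕ × ℕ) n) : Set where
    field
      col<size  : ∀ i → colAt ps i < M
      row≤col   : ∀ i → rowAt ps i ≤ colAt ps i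
      rows-onto : ∀ x → x < M → ∃ λ i → rowAt ps i ≡ x
      cols-onto : ∀ x → x < M → ∃ λ i → colAt ps i ≡ x
      monotone  : ∀ i j → toℕ i ≤ toℕ j → rowAt ps i ≤ rowAt ps j × colAt ps i ≤ colAt ps j

  open Layout

  rowVec : ∀ {n} M (ps : Vec (ℕ × ℕ) n) → .(Layout M ps) → Vec (Fin M) n
  rowVec M ps ok = tabulate (λ i → fromℕ< (≤-<-trans (row≤col ok i) (col<size ok i)))

  colVec : ∀ {n} M (ps : Vec (ℕ × ℕ) n) → .(Layout M ps) → Vec (Fin M) n
  colVec M ps ok = tabulate (λ i → fromℕ< (col<size ok i))

  lookup-rowVec : ∀ {n} M (ps : Vec (ℕ × ℕ) n) .(ok : Layout M ps) i → toℕ (lookup (rowVec M ps ok) i) ≡ rowAt ps i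
  lookup-rowVec M ps ok i = trans (cong toℕ (lookup∘tabulate _ i)) (toℕ-fromℕ< _)

  lookup-colVec : ∀ {n} M (ps : Vec (ℕ × ℕ) n) .(ok : Layout M ps) i → toℕ (lookup (colVec M ps ok) i) ≡ colAt ps i
  lookup-colVec M ps ok i = trans (cong toℕ (lookup∘tabulate _ i)) (toℕ-fromℕ< _)

  layoutNDPM : ∀ {n} M (ps : Vec (ℕ × ℕ) n) → .(Layout M ps) → NDPM n
  layoutNDPM M ps ok = record
    { m             = M
    ; row           = rowVec M ps ok
    ; col           = colVec M ps ok
    ; upper         = λ k → subst₂ _≤_ (sym (lookup-rowVec M ps ok k)) (sym (lookup-colVec M ps ok k)) (row≤col ok k)
    ; rowNonempty   = λ r → let i , eq = rows-onto ok (toℕ r) (toℕ<n r) in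
                            i , toℕ-injective (trans (lookup-rowVec M ps ok i) eq)
    ; colNonempty   = λ c → let i , eq = cols-onto ok (toℕ c) (toℕ<n c) in
                            i , toℕ-injective (trans (lookup-colVec M ps ok i) eq)
    ; colCond       = λ i j lt → col<⇒index< i j (subst₂ _<_ (lookup-colVec M ps ok i) (lookup-colVec M ps ok j) lt)
    ; nondecreasing = λ i j i<j → let rows≤ , cols≤ = monotone ok i j (<⇒≤ i<j) in
                        subst₂ _≤_ (sym (lookup-rowVec M ps ok i)) (sym (lookup-rowVec M ps ok j)) rows≤ ,
                        subst₂ _≤_ (sym (lookup-colVec M ps ok i)) (sym (lookup-colVec M ps ok j)) cols≤
    }
    where
    col<⇒index< : ∀ i j → colAt ps i < colAt ps j → toℕ i < toℕ j
    col<⇒index< i j lt with toℕ j ≤? toℕ i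
    ... | yes j≤i = ⊥-elim (<-irrefl refl (<-≤-trans lt (proj₂ (monotone ok j i j≤i))))
    ... | no  j≰i = ≰⇒> j≰i

  walk-layout : ∀ {L} (ps : Vec (ℕ × ℕ) L) → Walk 0 0 ps → Layout (suc (proj₁ (finalPosition 0 0 ps))) ((0 , 0) ∷ ps)
  walk-layout ps w = record
    { col<size  = λ i → s≤s (≤-trans (Walk-col≤final 0 0 ps w i) (≤-reflexive (sym (Walk-diagonal 0 0 ps w))))
    ; row≤col   = Walk-upper 0 0 ps w z≤n
    ; rows-onto = λ x x< → Walk-rows-onto 0 0 ps w x z≤n (≤-pred x<)
    ; cols-onto = λ x x< → Walk-cols-onto 0 0 ps w x z≤n (≤-trans (≤-pred x<) (≤-reflexive (Walk-diagonal 0 0 ps w)))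
    ; monotone  = Walk-monotone 0 0 ps w
    }

  -- The entry in cell (r , c) lies inside the first x rows and columns or outside both (0-based), so it
  -- does not prevent the matrix from splitting block-diagonally after x rows and columns.
  separates : ℕ × ℕ → ℕ → Bool
  separates (r , c) x = (c <ᵇ x) ∨ (x ≤ᵇ r)

  separatesAll : ∀ {n} → Vec (ℕ × ℕ) n → ℕ → Bool
  separatesAll []       x = true
  separatesAll (p ∷ ps) x = separates p x ∧ separatesAll ps x

  private
    isCut-tabulate : ∀ {n M} (ps : Vec (ℕ × ℕ) n) (rows cols : Fin n → Fin M) →
                     (∀ i → toℕ (rows i) ≡ rowAt ps i) → (∀ i → toℕ (cols i) ≡ colAt ps i) →
                     ∀ x → isCut (tabulate rows) (tabulate cols) x ≡ separatesAll ps x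
    isCut-tabulate []             rows cols rows≡ cols≡ x = refl
    isCut-tabulate ((r , c) ∷ ps) rows cols rows≡ cols≡ x rewrite rows≡ Fin.zero | cols≡ Fin.zero =
      cong (separates (r , c) x ∧_)
           (isCut-tabulate ps (rows ∘ Fin.suc) (cols ∘ Fin.suc) (rows≡ ∘ Fin.suc) (cols≡ ∘ Fin.suc) x)

  isCut-layout : ∀ {n} M (ps : Vec (ℕ × ℕ) n) .(ok : Layout M ps) x → isCut (rowVec M ps ok) (colVec M ps ok) x ≡ separatesAll ps x
  isCut-layout M ps ok = isCut-tabulate ps _ _ (λ i → toℕ-fromℕ< _) (λ i → toℕ-fromℕ< _)

  private
    <ᵇ-true : ∀ a b → a < b → (a <ᵇ b) ≡ true
    <ᵇ-true zero    (suc b) _         = refl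
    <ᵇ-true (suc a) (suc b) (s≤s a<b) = <ᵇ-true a b a<b

    <ᵇ-false : ∀ a b → b ≤ a → (a <ᵇ b) ≡ false
    <ᵇ-false a       zero    _         = refl
    <ᵇ-false (suc a) (suc b) (s≤s b≤a) = <ᵇ-false a b b≤a

    <ᵇ-sound : ∀ a b → (a <ᵇ b) ≡ true → a < b
    <ᵇ-sound zero    (suc b) _  = s≤s z≤n
    <ᵇ-sound (suc a) (suc b) eq = s≤s (<ᵇ-sound a b eq)

    ≤ᵇ-true : ∀ a b → a ≤ b → (a ≤ᵇ b) ≡ true
    ≤ᵇ-true zero    b _   = refl
    ≤ᵇ-true (suc a) b a<b = <ᵇ-true a b a<b

    ≤ᵇ-false : ∀ a b → b < a → (a ≤ᵇ b) ≡ false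
    ≤ᵇ-false (suc a) b (s≤s b≤a) = <ᵇ-false a b b≤a

    separates-below : ∀ {r c x} → r < x → separates (r , c) x ≡ (c <ᵇ x)
    separates-below {r} {c} {x} r<x rewrite ≤ᵇ-false x r r<x = Bool.∨-identityʳ _

    separates-left : ∀ {r c x} → c < x → separates (r , c) x ≡ true
    separates-left {c = c} {x} c<x rewrite <ᵇ-true c x c<x = refl

    crosses : ∀ {r c x} → r < x → x ≤ c → separates (r , c) x ≡ false
    crosses {r} {c} {x} r<x x≤c rewrite <ᵇ-false c x x≤c | ≤ᵇ-false x r r<x = refl

    separates-weaken : ∀ {r c r′ c′ x} → r < x → r′ < x → c ≤ c′ →
                       separates (r′ , c′) x ≡ true → separates (r , c) x ≡ true
    separates-weaken {c = c} {c′ = c′} {x} r<x r′<x c≤c′ sep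
      rewrite separates-below {c = c} r<x | separates-below {c = c′} r′<x = <ᵇ-true c x (≤-<-trans c≤c′ (<ᵇ-sound c′ x sep))

    walk-separatesAll-above : ∀ {L} r c (ps : Vec (ℕ × ℕ) L) → Walk r c ps →
                              ∀ x → x ≤ r → separatesAll ((r , c) ∷ ps) x ≡ true
    walk-separatesAll-above r c [] w x x≤r rewrite ≤ᵇ-true x r x≤r | Bool.∨-zeroʳ (c <ᵇ x) = refl
    walk-separatesAll-above r c ((r′ , c′) ∷ ps) (m , w) x x≤r rewrite ≤ᵇ-true x r x≤r | Bool.∨-zeroʳ (c <ᵇ x) =
      walk-separatesAll-above r′ c′ ps w x (≤-trans x≤r (Move.row≤ m))

  interval : ℕ → ℕ → List ℕ
  interval a zero    = []
  interval a (suc n) = a ∷ interval (suc a) n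

  count : (ℕ → Bool) → List ℕ → ℕ
  count f []       = 0
  count f (x ∷ xs) = if f x then suc (count f xs) else count f xs

  length-filter≡count : ∀ (f : ℕ → Bool) xs → length (filter (λ x → f x Bool.≟ true) xs) ≡ count f xs
  length-filter≡count f []       = refl
  length-filter≡count f (x ∷ xs) with f x
  ... | true  = cong suc (length-filter≡count f xs)
  ... | false = length-filter≡count f xs

  count-cong : ∀ xs (f g : ℕ → Bool) → (∀ x → f x ≡ g x) → count f xs ≡ count g xs
  count-cong []       f g f≗g = refl
  count-cong (x ∷ xs) f g f≗g rewrite f≗g x | count-cong xs f g f≗g = refl

  map-suc-upTo : ∀ n → map suc (upTo n) ≡ interval 1 n
  map-suc-upTo n = shifted n (λ i → i) 0 (λ i → refl)
    where
    shifted : ∀ n (f : ℕ → ℕ) a → (∀ i → f i ≡ a + i) → map suc (applyUpTo f n) ≡ interval (suc a) n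
    shifted zero    f a f≡ = refl
    shifted (suc n) f a f≡ = cong₂ _∷_ (cong suc (trans (f≡ 0) (+-identityʳ a)))
                                      (shifted n (f ∘ suc) (suc a) (λ i → trans (f≡ (suc i)) (+-suc a i)))

  private
    count-interval-cong : ∀ a n (f g : ℕ → Bool) → (∀ x → a ≤ x → f x ≡ g x) →
                          count f (interval a n) ≡ count g (interval a n)
    count-interval-cong a zero    f g f≗g = refl
    count-interval-cong a (suc n) f g f≗g
      rewrite f≗g a ≤-refl | count-interval-cong (suc a) n f g (λ x a<x → f≗g x (<⇒≤ a<x)) = refl

    count-dropHead : ∀ {L} p q (ps : Vec (ℕ × ℕ) L) a n → (∀ x → a ≤ x → separates q x ≡ true → separates p x ≡ true) →
      count (separatesAll (p ∷ q ∷ ps)) (interval a n) ≡ count (separatesAll (q ∷ ps)) (interval a n)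
    count-dropHead p q ps a n q⇒p = count-interval-cong a n _ _ λ x a≤x → absorb (separates p x) (separates q x) (q⇒p x a≤x)
      where
      absorb : ∀ b b′ {rest} → (b′ ≡ true → b ≡ true) → b ∧ (b′ ∧ rest) ≡ b′ ∧ rest
      absorb b true  b′⇒b rewrite b′⇒b refl = refl
      absorb b false b′⇒b = Bool.∧-zeroʳ b

    count-skip : ∀ f a xs → f a ≡ false → count f (a ∷ xs) ≡ count f xs
    count-skip f a xs fa≡ rewrite fa≡ = refl

    count-hit : ∀ f a xs → f a ≡ true → count f (a ∷ xs) ≡ suc (count f xs)
    count-hit f a xs fa≡ rewrite fa≡ = refl

    ∸-unfold : ∀ F r → r < F → F ∸ r ≡ suc (F ∸ suc r)
    ∸-unfold (suc F) zero    _         = refl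
    ∸-unfold (suc F) (suc r) (s≤s r<F) = ∸-unfold F r r<F

  -- The cuts of the walk of p lie in rows r + 1, …, finalRow p r; each one is a level′ step at height 0.
  cuts-positions : ∀ {L h k} (p : Motzkin L h k) r c → c ≡ r + h →
                   count (separatesAll ((r , c) ∷ positions p r c)) (interval (suc r) (finalRow p r ∸ r)) ≡ k
  cuts-positions end r c c≡ rewrite n∸n≡0 r = refl
  cuts-positions (level p) r c c≡ =
    trans (count-dropHead (r , c) (r , c) (positions p r c) (suc r) (finalRow p r ∸ r)
                          λ x r<x → separates-weaken r<x r<x ≤-refl)
          (cuts-positions p r c c≡)
  cuts-positions (rise p) r c c≡ =
    trans (count-dropHead (r , c) (r , suc c) (positions p r (suc c)) (suc r) (finalRow p r ∸ r)
                          λ x r<x → separates-weaken r<x r<x (n≤1+n c))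
          (cuts-positions p r (suc c) (height-rise c≡))
  cuts-positions (fall p) r c c≡ rewrite ∸-unfold (finalRow p (suc r)) r (finalRow-≥ p (suc r)) =
    trans (count-skip (separatesAll ((r , c) ∷ q ∷ ps)) (suc r) (interval (suc (suc r)) n)
                      (cong (_∧ separatesAll (q ∷ ps) (suc r)) (crosses (n<1+n r) r<c)))
   (trans (count-dropHead (r , c) q ps (suc (suc r)) n
                          λ x r+1<x → separates-weaken (<-trans (n<1+n r) r+1<x) r+1<x ≤-refl)
          (cuts-positions p (suc r) c (height-fall c≡)))
    where
    q = (suc r , c)
    ps = positions p (suc r) c
    n = finalRow p (suc r) ∸ suc r
    r<c : suc r ≤ c
    r<c = ≤-trans (m≤m+n (suc r) _) (≤-reflexive (sym (height-fall c≡)))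
  cuts-positions (level′ p) r c c≡ rewrite ∸-unfold (finalRow p (suc r)) r (finalRow-≥ p (suc r)) =
    trans (count-skip (separatesAll ((r , c) ∷ q ∷ ps)) (suc r) (interval (suc (suc r)) n)
                      (cong (_∧ separatesAll (q ∷ ps) (suc r)) (crosses (n<1+n r) r<c)))
   (trans (count-dropHead (r , c) q ps (suc (suc r)) n
                          λ x r+1<x → separates-weaken (<-trans (n<1+n r) r+1<x) r+1<x (n≤1+n c))
          (cuts-positions p (suc r) (suc c) (cong suc c≡)))
    where
    q = (suc r , suc c)
    ps = positions p (suc r) (suc c)
    n = finalRow p (suc r) ∸ suc r
    r<c : suc r ≤ c
    r<c = ≤-trans (m≤m+n (suc r) _) (≤-reflexive (sym (height-fall c≡)))
  cuts-positions (level′₀ p) r c c≡ rewrite ∸-unfold (finalRow p (suc r)) r (finalRow-≥ p (suc r)) =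
    trans (count-hit (separatesAll ((r , c) ∷ q ∷ ps)) (suc r) (interval (suc (suc r)) n)
                     (trans (cong (_∧ separatesAll (q ∷ ps) (suc r)) (separates-left {r} (s≤s c≤r)))
                            (walk-separatesAll-above (suc r) (suc c) ps (positions-walk p (suc r) (suc c) (cong suc c≡)) (suc r) ≤-refl)))
          (cong suc (trans (count-dropHead (r , c) q ps (suc (suc r)) n
                                           λ x r+1<x _ → separates-left (<-trans (s≤s c≤r) r+1<x))
                           (cuts-positions p (suc r) (suc c) (cong suc c≡))))
    where
    q = (suc r , suc c)
    ps = positions p (suc r) (suc c)
    n = finalRow p (suc r) ∸ suc r
    c≤r : c ≤ r
    c≤r = ≤-reflexive (trans c≡ (+-identityʳ r))

module NDPMs where

  open import Defs
  open MotzkinPaths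
  open LevelSets
  open Walks
  open Layouts
  open import Data.Nat as ℕ using (ℕ; zero; suc; _≤_; _<_; _≤?_; z≤n; s≤s)
  open import Data.Nat.Properties
  open import Data.Fin using (Fin; toℕ; fromℕ; fromℕ<; inject₁)
  import Data.Fin as Fin
  open import Data.Fin.Properties using (toℕ-fromℕ<; toℕ-injective; toℕ<n; toℕ-inject₁; toℕ-fromℕ)
  open import Data.Vec using (Vec; _∷_; lookup; tabulate)
  open import Data.Vec.Properties using (lookup∘tabulate; tabulate∘lookup; tabulate-cong)
  open import Data.List using (map; upTo)
  open import Data.Product using (Σ; ∃; _×_; _,_; proj₁; proj₂)
  open import Data.Product.Properties using (≡-dec)
  open import Function using (_∘_)
  open import Function.Bundles using (_↔_)
  open import Relation.Nullary using (¬_; yes; no; contradiction)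
  open import Relation.Nullary.Decidable using (recompute)
  open import Relation.Binary.PropositionalEquality

  -- The row (or column) indices of a nondecreasing partition matrix, read along 1, 2, …, n.
  module MonotoneOnto {M L : ℕ} (f : Fin (suc L) → ℕ) (f<M : ∀ i → f i < M)
                      (onto : ∀ x → x < M → ∃ λ i → f i ≡ x) (mono : ∀ i j → toℕ i < toℕ j → f i ≤ f j) where

    mono≤ : ∀ i j → toℕ i ≤ toℕ j → f i ≤ f j
    mono≤ i j i≤j with toℕ i ℕ.≟ toℕ j
    ... | yes i≡j rewrite toℕ-injective {i = i} {j = j} i≡j = ≤-refl
    ... | no  i≢j = mono i j (≤∧≢⇒< i≤j i≢j)

    starts-at-zero : f Fin.zero ≡ 0
    starts-at-zero = let j , fj≡0 = onto 0 (≤-<-trans z≤n (f<M Fin.zero)) in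
                     n≤0⇒n≡0 (≤-trans (mono≤ Fin.zero j z≤n) (≤-reflexive fj≡0))

    ends-at-top : suc (f (fromℕ L)) ≡ M
    ends-at-top = ≤-antisym (f<M (fromℕ L)) (bounded M ≤-refl)
      where
      bounded : ∀ x → x ≤ M → x ≤ suc (f (fromℕ L))
      bounded zero    _   = z≤n
      bounded (suc x) x<M = let j , fj≡x = onto x x<M in
        s≤s (≤-trans (≤-reflexive (sym fj≡x)) 
          (mono≤ j (fromℕ L) (≤-trans (≤-pred (toℕ<n j)) (≤-reflexive (sym (toℕ-fromℕ L))))))

    no-gaps : ∀ (i : Fin L) → f (Fin.suc i) ≤ suc (f (inject₁ i))
    no-gaps i with f (Fin.suc i) ≤? suc (f (inject₁ i))
    ... | yes fits = fits
    ... | no  jump = contradiction (onto (suc (f (inject₁ i))) (<-trans (≰⇒> jump) (f<M (Fin.suc i)))) skipped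
      where
      skipped : ¬ ∃ λ j → f j ≡ suc (f (inject₁ i))
      skipped (j , fj≡) with toℕ j ≤? toℕ (inject₁ i)
      ... | yes j≤i = <-irrefl refl (≤-trans (≤-reflexive (sym fj≡)) (mono≤ j (inject₁ i) j≤i))
      ... | no  j≰i = <-irrefl refl (≤-trans (≰⇒> jump) (≤-trans (mono≤ (Fin.suc i) j i<j) (≤-reflexive fj≡)))
        where
        i<j : toℕ (Fin.suc i) ≤ toℕ j
        i<j = ≤-trans (s≤s (≤-reflexive (sym (toℕ-inject₁ i)))) (≰⇒> j≰i)

    step : ∀ (i : Fin L) → f (inject₁ i) ≤ f (Fin.suc i)
    step i = mono (inject₁ i) (Fin.suc i) (s≤s (≤-reflexive (toℕ-inject₁ i)))

  private
    tabulate-walk : ∀ n (g : Fin (suc n) → ℕ × ℕ) →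
      (∀ (i : Fin n) → Move (proj₁ (g (inject₁ i))) (proj₂ (g (inject₁ i))) (proj₁ (g (Fin.suc i))) (proj₂ (g (Fin.suc i)))) →
      proj₁ (g (fromℕ n)) ≡ proj₂ (g (fromℕ n)) →
      Walk (proj₁ (g Fin.zero)) (proj₂ (g Fin.zero)) (tabulate (g ∘ Fin.suc))
    tabulate-walk zero    g moves diagonal = diagonal
    tabulate-walk (suc n) g moves diagonal = moves Fin.zero , tabulate-walk n (g ∘ Fin.suc) (moves ∘ Fin.suc) diagonal

    finalPosition-tabulate : ∀ n (g : Fin (suc n) → ℕ × ℕ) →
      finalPosition (proj₁ (g Fin.zero)) (proj₂ (g Fin.zero)) (tabulate (g ∘ Fin.suc)) ≡ g (fromℕ n)
    finalPosition-tabulate zero    g = refl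
    finalPosition-tabulate (suc n) g = finalPosition-tabulate n (g ∘ Fin.suc)

  record Shape {L} (M : ℕ) (rows cols : Vec (Fin M) (suc L)) : Set where
    field
      origin : (toℕ (lookup rows Fin.zero) , toℕ (lookup cols Fin.zero)) ≡ (0 , 0)
      walk   : Walk 0 0 (tabulate (λ i → toℕ (lookup rows (Fin.suc i)) , toℕ (lookup cols (Fin.suc i))))
      size   : suc (toℕ (lookup rows (fromℕ L))) ≡ M

  ndpm-shape : ∀ {L} M (rows cols : Vec (Fin M) (suc L)) →
    (∀ k → toℕ (lookup rows k) ≤ toℕ (lookup cols k)) →
    (∀ r → ∃ λ k → lookup rows k ≡ r) → (∀ c → ∃ λ k → lookup cols k ≡ c) →
    (∀ i j → toℕ i < toℕ j → toℕ (lookup rows i) ≤ toℕ (lookup rows j) × toℕ (lookup cols i) ≤ toℕ (lookup cols j)) →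
    Shape M rows cols
  ndpm-shape {L} M rows cols upper rows-onto cols-onto nondecreasing = record
    { origin = cong₂ _,_ R.starts-at-zero C.starts-at-zero
    ; walk   = subst₂ (λ r c → Walk r c (tabulate (cell ∘ Fin.suc))) R.starts-at-zero C.starts-at-zero
                 (tabulate-walk L cell (λ i → move (R.step i) (R.no-gaps i) (C.step i) (C.no-gaps i) (upper (Fin.suc i)))
                                       (suc-injective (trans R.ends-at-top (sym C.ends-at-top))))
    ; size   = R.ends-at-top
    }
    where
    cell : Fin (suc L) → ℕ × ℕ
    cell i = toℕ (lookup rows i) , toℕ (lookup cols i)
    toℕ-onto : ∀ (v : Vec (Fin M) (suc L)) → (∀ r → ∃ λ k → lookup v k ≡ r) →
               ∀ x → x < M → ∃ λ i → toℕ (lookup v i) ≡ x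
    toℕ-onto v onto x x<M = let k , eq = onto (fromℕ< x<M) in k , trans (cong toℕ eq) (toℕ-fromℕ< x<M)
    module R = MonotoneOnto (λ i → toℕ (lookup rows i)) (λ i → toℕ<n _) (toℕ-onto rows rows-onto)
                            (λ i j i<j → proj₁ (nondecreasing i j i<j))
    module C = MonotoneOnto (λ i → toℕ (lookup cols i)) (λ i → toℕ<n _) (toℕ-onto cols cols-onto)
                            (λ i j i<j → proj₂ (nondecreasing i j i<j))

  toNDPM : ∀ {L} → Σ ℕ (Motzkin L 0) → NDPM (suc L)
  toNDPM (k , p) = layoutNDPM (suc (proj₁ (finalPosition 0 0 (positions p 0 0)))) ((0 , 0) ∷ positions p 0 0)
                              (walk-layout (positions p 0 0) (positions-walk p 0 0 refl))

  fromNDPM : ∀ {L} → NDPM (suc L) → Σ ℕ (Motzkin L 0)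
  fromNDPM {L} record { m = M ; row = rows ; col = cols ; upper = up
                       ; rowNonempty = rn ; colNonempty = cn ; nondecreasing = nd } =
    decodeWalk L 0 0 0 refl (tabulate (λ i → toℕ (lookup rows (Fin.suc i)) , toℕ (lookup cols (Fin.suc i))))
               (Shape.walk (ndpm-shape M rows cols up rn cn nd))

  blk-toNDPM : ∀ {L} k (p : Motzkin L 0 k) → blk (toNDPM (k , p)) ≡ suc k
  blk-toNDPM {L} k p = cong suc (begin
    _ ≡⟨ length-filter≡count _ (map suc (upTo F)) ⟩
    count (isCut (rowVec M ps ok) (colVec M ps ok)) (map suc (upTo F))
      ≡⟨ count-cong (map suc (upTo F)) _ _ (isCut-layout M ps ok) ⟩
    count (separatesAll ps) (map suc (upTo F))
      ≡⟨ cong (count (separatesAll ps)) (map-suc-upTo F) ⟩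
    count (separatesAll ps) (interval 1 F)
      ≡⟨ cong (count (separatesAll ps) ∘ interval 1) (finalPosition-positions p 0 0) ⟩
    count (separatesAll ps) (interval 1 (finalRow p 0))
      ≡⟨ cuts-positions p 0 0 refl ⟩
    k ∎)
    where
    open ≡-Reasoning
    ps = (0 , 0) ∷ positions p 0 0
    F = proj₁ (finalPosition 0 0 (positions p 0 0))
    M = suc F
    ok = walk-layout (positions p 0 0) (positions-walk p 0 0 refl)

  fromNDPM-toNDPM : ∀ {L} (a : Σ ℕ (Motzkin L 0)) → fromNDPM (toNDPM a) ≡ a
  fromNDPM-toNDPM {L} (k , p) = trans (decodeWalk-cong cells≡ _ (positions-walk p 0 0 refl)) (decodeWalk-positions p 0 0 _ _)
    where
    ps = (0 , 0) ∷ positions p 0 0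
    M = suc (proj₁ (finalPosition 0 0 (positions p 0 0)))
    ok = walk-layout (positions p 0 0) (positions-walk p 0 0 refl)
    cells≡ : tabulate (λ i → toℕ (lookup (rowVec M ps ok) (Fin.suc i)) , toℕ (lookup (colVec M ps ok) (Fin.suc i))) ≡ positions p 0 0
    cells≡ = trans (tabulate-cong (λ i → cong₂ _,_ (lookup-rowVec M ps ok (Fin.suc i)) (lookup-colVec M ps ok (Fin.suc i))))
                   (tabulate∘lookup (positions p 0 0))
    decodeWalk-cong : ∀ {qs qs′ : Vec (ℕ × ℕ) L} → qs ≡ qs′ → .(w : Walk 0 0 qs) .(w′ : Walk 0 0 qs′) →
                      decodeWalk L 0 0 0 refl qs w ≡ decodeWalk L 0 0 0 refl qs′ w′
    decodeWalk-cong refl w w′ = refl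

  private
    NDPM-≡ : ∀ {n} (A B : NDPM n) → m A ≡ m B →
             (∀ i → toℕ (lookup (row A) i) ≡ toℕ (lookup (row B) i)) →
             (∀ i → toℕ (lookup (col A) i) ≡ toℕ (lookup (col B) i)) → A ≡ B
    NDPM-≡ record { m = M ; row = rowsA ; col = colsA } record { m = .M ; row = rowsB ; col = colsB }
           refl rows≡ cols≡ =
      same (vec-≡ rowsA rowsB rows≡) (vec-≡ colsA colsB cols≡)
      where
      vec-≡ : ∀ {n} (u v : Vec (Fin M) n) → (∀ i → toℕ (lookup u i) ≡ toℕ (lookup v i)) → u ≡ v
      vec-≡ u v u≗v = trans (sym (tabulate∘lookup u)) (trans (tabulate-cong (toℕ-injective ∘ u≗v)) (tabulate∘lookup v))
      same : rowsA ≡ rowsB → colsA ≡ colsB → _ ≡ _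
      same refl refl = refl

  toNDPM-fromNDPM : ∀ {L} (A : NDPM (suc L)) → toNDPM (fromNDPM A) ≡ A
  toNDPM-fromNDPM {L} A@(record { m = M ; row = rows ; col = cols ; upper = up
                                 ; rowNonempty = rn ; colNonempty = cn ; nondecreasing = nd }) =
    NDPM-≡ (toNDPM (fromNDPM A)) A size≡ rows≡ cols≡
    where
    cell : Fin (suc L) → ℕ × ℕ
    cell i = toℕ (lookup rows i) , toℕ (lookup cols i)
    p = proj₂ (fromNDPM A)
    positions≡ : positions p 0 0 ≡ tabulate (cell ∘ Fin.suc)
    positions≡ = positions-decodeWalk L 0 0 0 refl (tabulate (cell ∘ Fin.suc)) _
    origin≡ : (0 , 0) ≡ cell Fin.zero
    origin≡ = sym (recompute (≡-dec ℕ._≟_ ℕ._≟_ (cell Fin.zero) (0 , 0)) (Shape.origin (ndpm-shape M rows cols up rn cn nd)))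
    cells≡ : (0 , 0) ∷ positions p 0 0 ≡ tabulate cell
    cells≡ = cong₂ _∷_ origin≡ positions≡
    size≡ : suc (proj₁ (finalPosition 0 0 (positions p 0 0))) ≡ M
    size≡ = begin
      suc (proj₁ (finalPosition 0 0 (positions p 0 0)))
        ≡⟨ cong (suc ∘ proj₁ ∘ finalPosition 0 0) positions≡ ⟩
      suc (proj₁ (finalPosition 0 0 (tabulate (cell ∘ Fin.suc))))
        ≡⟨ cong (λ q → suc (proj₁ (finalPosition (proj₁ q) (proj₂ q) (tabulate (cell ∘ Fin.suc))))) origin≡ ⟩
      suc (proj₁ (finalPosition (proj₁ (cell Fin.zero)) (proj₂ (cell Fin.zero)) (tabulate (cell ∘ Fin.suc))))
        ≡⟨ cong (suc ∘ proj₁) (finalPosition-tabulate L cell) ⟩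
      suc (toℕ (lookup rows (fromℕ L)))
        ≡⟨ recompute (_ ℕ.≟ M) (Shape.size (ndpm-shape M rows cols up rn cn nd)) ⟩
      M ∎
      where open ≡-Reasoning
    ok = walk-layout (positions p 0 0) (positions-walk p 0 0 refl)
    M′ = suc (proj₁ (finalPosition 0 0 (positions p 0 0)))
    rows≡ : ∀ i → toℕ (lookup (row (toNDPM (fromNDPM A))) i) ≡ toℕ (lookup rows i)
    rows≡ i = trans (lookup-rowVec M′ _ ok i)
                    (trans (cong (λ qs → proj₁ (lookup qs i)) cells≡) (cong proj₁ (lookup∘tabulate cell i)))
    cols≡ : ∀ i → toℕ (lookup (col (toNDPM (fromNDPM A))) i) ≡ toℕ (lookup cols i)
    cols≡ i = trans (lookup-colVec M′ _ ok i)
                    (trans (cong (λ qs → proj₂ (lookup qs i)) cells≡) (cong proj₂ (lookup∘tabulate cell i)))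

  ndpm↔Motzkin : ∀ L K → (Σ (NDPM (suc L)) λ A → blk A ≡ K) ↔ Shifted (Motzkin L 0) K
  ndpm↔Motzkin L = levelSet↔ blk toNDPM fromNDPM fromNDPM-toNDPM toNDPM-fromNDPM blk-toNDPM

open import Defs
open import Data.Nat using (ℕ; _≤_; _∸_; suc; s≤s; z≤n)
open import Data.Fin using (Fin)
open import Data.Fin.Permutation using (↔⇒≡)
open import Data.Fin.Properties using (0↔⊥)
open import Data.Product using (Σ; _×_; _,_)
open import Data.Integer using (+_)
open import Function.Bundles using (_↔_)
open import Function.Properties.Inverse using (↔-sym; ↔-trans)
open import Relation.Binary.PropositionalEquality using (_≡_; sym; trans)
open BallotNumbers using (ballot; double)
open MotzkinPaths using (Motzkin; Motzkin↔Fin; motzkinCount≡ballot)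
open LevelSets using (Shifted)
open GeneratingFunction using (denom⋆genSeries≈numer)
open DyckPaths using (dyck↔Motzkin)
open NDPMs using (ndpm↔Motzkin)

theorem4p11 :
    (∀ (n : ℕ) → 1 ≤ n → ∀ (k : ℕ) →
      (Σ (NDPM n) λ A → blk A ≡ k) ↔ (Σ (Dyck n) λ D → touch D ≡ k))
    ×
    (∀ (c : ℕ → ℕ → ℕ) →
      (∀ (n : ℕ) → 1 ≤ n → ∀ (k : ℕ) → (Σ (NDPM n) λ A → blk A ≡ k) ↔ Fin (c n k)) →
      ∀ (S : Series) → S 0 0 ≡ + 1 → (S ⋆ S) ≈ₛ oneMinus4t →
      (denom ⋆ genSeries c) ≈ₛ numer S)
theorem4p11 = equidistributed , generatingFunction
  where
  equidistributed : ∀ n → 1 ≤ n → ∀ k → (Σ (NDPM n) λ A → blk A ≡ k) ↔ (Σ (Dyck n) λ D → touch D ≡ k)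
  equidistributed (suc L) _ k = ↔-trans (ndpm↔Motzkin L k) (↔-sym (dyck↔Motzkin L k))

  generatingFunction : ∀ c → (∀ n → 1 ≤ n → ∀ k → (Σ (NDPM n) λ A → blk A ≡ k) ↔ Fin (c n k)) →
    ∀ (S : Series) → S 0 0 ≡ + 1 → (S ⋆ S) ≈ₛ oneMinus4t → (denom ⋆ genSeries c) ≈ₛ numer S
  generatingFunction c counts S = denom⋆genSeries≈numer c c-ballot c-zero {S}
    where
    Motzkin↔c : ∀ L k → Shifted (Motzkin L 0) k ↔ Fin (c (suc L) k)
    Motzkin↔c L k = ↔-trans (↔-sym (ndpm↔Motzkin L k)) (counts (suc L) (s≤s z≤n) k)

    c-ballot : ∀ L k → c (suc L) (suc k) ≡ ballot (double L ∸ k) k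
    c-ballot L k = trans (sym (↔⇒≡ (↔-trans (↔-sym (Motzkin↔Fin L 0 k)) (Motzkin↔c L (suc k)))))
                         (motzkinCount≡ballot L 0 k)

    c-zero : ∀ L → c (suc L) 0 ≡ 0
    c-zero L = sym (↔⇒≡ (↔-trans 0↔⊥ (Motzkin↔c L 0)))
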